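{- Let $m,n>2$ and let $C$ be an $m\times n$ evolutionary stable configuration. Then for every integer $k\ge 0$ with $m-1-2k\ge 1$, row $m-1-2k$ of $C$ is the string $101\,101\cdots101$ (the block $101$ repeated $n/3$ times), i.e. $C_{m-1-2k,j}=0$ if $j\equiv2\pmod 3$ and $C_{m-1-2k,j}=1$ otherwise.
   Context: An $m\times n$ configuration is a $0$-$1$ matrix $C=(C_{i,j})$, $1\le i\le m$, $1\le j\le n$; row $1$ is the northernmost and row $m$ the southernmost, column $1$ the westernmost and column $n$ the easternmost; $C_{i,j}=1$ means lot $(i,j)$ is occupied by a house. A house at $(i,j)$ is blocked if $j>1$ and $C_{i,j-1}=1$, and $j<n$ and $C_{i,j+1}=1$, and $i<m$ and $C_{i+1,j}=1$. $C$ is permissible if no house is blocked; it is maximal if it is permissible and occupying any single empty lot yields a non-permissible configuration. A maximal configuration is resistant to predators if for every empty lot $(i,j)$, after setting $C_{i,j}=1$ the new house at $(i,j)$ is blocked; it is resistant to altruists if for every empty lot $(i,j)$, after setting $C_{i,j}=1$ some house at a position other than $(i,j)$ is blocked. An evolutionary stable configuration is a maximal configuration resistant to both predators and altruists. -}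

module Defs where

open import Data.Nat using (ℕ; zero; suc; _+_; _∸_; _≤_; _<_; _≤?_)
open import Data.Nat.DivMod using (_%_)
open import Data.Bool using (Bool; true; false; if_then_else_)
open import Data.Fin using (Fin; toℕ)
open import Data.Product using (_×_; Σ; ∃; _,_)
open import Relation.Binary.PropositionalEquality using (_≡_; _≢_)
open import Relation.Nullary using (¬_)
open import Relation.Nullary.Decidable using (⌊_⌋)
open import Data.Nat using (_≡ᵇ_)

-- An m × n configuration, given by its entries C i j ∈ {0,1} (true = 1 = house),
-- with 1-based indices 1 ≤ i ≤ m, 1 ≤ j ≤ n. Entries outside that range are
-- irrelevant (every predicate below only looks at in-range lots).
Config : Set
Config = ℕ → ℕ → Bool

InGrid : ℕ → ℕ → ℕ → ℕ → Set
InGrid m n i j = (1 ≤ i × i ≤ m) × (1 ≤ j × j ≤ n)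

Blocked : ℕ → ℕ → Config → ℕ → ℕ → Set
Blocked m n C i j =
  C i j ≡ true ×
  (1 < j × C i (j ∸ 1) ≡ true) ×
  (j < n × C i (suc j) ≡ true) ×
  (i < m × C (suc i) j ≡ true)

Permissible : ℕ → ℕ → Config → Set
Permissible m n C = ∀ i j → InGrid m n i j → ¬ Blocked m n C i j

occupy : Config → ℕ → ℕ → Config
occupy C i j i' j' = if ⌊ i' Data.Nat.≟ i ⌋ then (if ⌊ j' Data.Nat.≟ j ⌋ then true else C i' j') else C i' j'

Empty : ℕ → ℕ → Config → ℕ → ℕ → Set
Empty m n C i j = InGrid m n i j × C i j ≡ false

Maximal : ℕ → ℕ → Config → Set
Maximal m n C =
  Permissible m n C ×
  (∀ i j → Empty m n C i j → ¬ Permissible m n (occupy C i j))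

ResistantToPredators : ℕ → ℕ → Config → Set
ResistantToPredators m n C =
  ∀ i j → Empty m n C i j → Blocked m n (occupy C i j) i j

ResistantToAltruists : ℕ → ℕ → Config → Set
ResistantToAltruists m n C =
  ∀ i j → Empty m n C i j →
    ∃ λ i' → ∃ λ j' → InGrid m n i' j' × ¬ (i' ≡ i × j' ≡ j) ×
      Blocked m n (occupy C i j) i' j'

EvolutionaryStable : ℕ → ℕ → Config → Set
EvolutionaryStable m n C =
  Maximal m n C × ResistantToPredators m n C × ResistantToAltruists m n C

{-# OPTIONS --safe #-}
-- Predator resistance gives every vacant lot houses to its west, east and south. Hence the first
-- and last columns and the bottom row are full, vacant lots are isolated, and no row above the
-- bottom one has four consecutive houses: such a row consists of runs of 1, 2 or 3 houses between
-- single vacancies, and counting runs gives  n + s_r = 3 z_r + t_r + 2  (z_r vacancies, s_r runs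
-- of one house, t_r runs of three). Altruist resistance makes the vacancies of two consecutive rows
-- alternate, so  z_r + w_{r+1} = z_{r+1} + 1,  where w_r counts the vacancies in columns 2 and n - 1,
-- and w_r + w_{r+1} ≤ 2; thus z_r + z_{r+1} decreases downwards. Moreover t_{m-1} = 0, an interior
-- single house in row r + 2 forces a run of three in row r, and row 2 has no interior single house
-- but a vacancy or a run of three at each end. Played against each other along the rows from 2 to
-- m - 1 these relations are all tight: rows m - 1, m - 3, … have w = 2 and t = 0, so all their
-- runs have length 2 except the two at the walls, which is the pattern 101 101 … 101. For n = 3 the
-- middle column simply alternates upwards from the full bottom row.
module Submission where

open import Defs
open import Data.Nat using (ℕ; _+_; _*_; _∸_; _≤_; _<_)
open import Data.Nat.DivMod using (_%_)
open import Data.Bool using (true; false)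
open import Data.Product using (_×_)
open import Relation.Binary.PropositionalEquality using (_≡_; _≢_)

open import Data.Nat using (zero; suc; z≤n; s≤s; _≟_; _≡ᵇ_; _≤ᵇ_)
open import Data.Nat.Properties
open import Data.Nat.DivMod using ([m+kn]%n≡m%n)
open import Data.Bool using (Bool; _∧_; _∨_; not; if_then_else_)
open import Data.Bool.Properties
  using (∧-conicalˡ; ∧-conicalʳ; ∧-zeroʳ; ∧-identityʳ; ∨-zeroʳ; not-injective; not-involutive; T-≡)
open import Data.Product using (_,_; proj₁; proj₂; ∃)
open import Data.Sum using (_⊎_; inj₁; inj₂)
open import Data.Empty using (⊥; ⊥-elim)
open import Function.Bundles using (module Equivalence)
open import Relation.Nullary using (¬_; yes; no; contradiction)
open import Relation.Binary.PropositionalEquality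
  using (refl; sym; trans; cong; cong₂; subst; module ≡-Reasoning)
open import Data.Nat.Tactic.RingSolver using (solve)
open import Data.List using (_∷_; [])
open import Algebra.Properties.CommutativeSemigroup +-commutativeSemigroup using (interchange; xy∙z≈xz∙y)

⟦_⟧ : Bool → ℕ
⟦ true ⟧ = 1
⟦ false ⟧ = 0

⟦⟧≤1 : ∀ b → ⟦ b ⟧ ≤ 1
⟦⟧≤1 true = ≤-refl
⟦⟧≤1 false = z≤n

⟦⟧≡0⇒false : ∀ {b} → ⟦ b ⟧ ≡ 0 → b ≡ false
⟦⟧≡0⇒false {false} _ = refl

⟦⟧+⟦⟧≡2⇒both : ∀ a b → ⟦ a ⟧ + ⟦ b ⟧ ≡ 2 → (a ≡ true) × (b ≡ true)
⟦⟧+⟦⟧≡2⇒both true true _ = refl , refl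
⟦⟧+⟦⟧≡2⇒both true false ()
⟦⟧+⟦⟧≡2⇒both false true ()
⟦⟧+⟦⟧≡2⇒both false false ()

⟦⟧+⟦⟧≤1 : ∀ a b → a ∧ b ≡ false → ⟦ a ⟧ + ⟦ b ⟧ ≤ 1
⟦⟧+⟦⟧≤1 true false _ = ≤-refl
⟦⟧+⟦⟧≤1 false b _ = ⟦⟧≤1 b

∑ : (ℕ → ℕ) → ℕ → ℕ
∑ f zero = 0
∑ f (suc N) = ∑ f N + f (suc N)

module _ (f : ℕ → ℕ) where

  ∑-zero : ∀ N → (∀ j → 1 ≤ j → j ≤ N → f j ≡ 0) → ∑ f N ≡ 0
  ∑-zero zero _ = refl
  ∑-zero (suc N) h = cong₂ _+_ (∑-zero N (λ j 1≤j j≤N → h j 1≤j (m≤n⇒m≤1+n j≤N))) (h (suc N) (s≤s z≤n) ≤-refl)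

  ∑-*ˡ : ∀ c N → ∑ (λ j → c * f j) N ≡ c * ∑ f N
  ∑-*ˡ c zero = sym (*-zeroʳ c)
  ∑-*ˡ c (suc N) = trans (cong (_+ c * f (suc N)) (∑-*ˡ c N)) (sym (*-distribˡ-+ c (∑ f N) (f (suc N))))

  term≤∑ : ∀ N a → 1 ≤ a → a ≤ N → f a ≤ ∑ f N
  term≤∑ zero _ (s≤s _) ()
  term≤∑ (suc N) a 1≤a a≤1+N with m≤n⇒m<n∨m≡n a≤1+N
  ... | inj₁ (s≤s a≤N) = ≤-trans (term≤∑ N a 1≤a a≤N) (m≤m+n (∑ f N) (f (suc N)))
  ... | inj₂ refl = m≤n+m (f (suc N)) (∑ f N)

  two-terms≤∑ : ∀ N a b → 1 ≤ a → a < b → b ≤ N → f a + f b ≤ ∑ f N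
  two-terms≤∑ zero _ _ _ (s≤s _) ()
  two-terms≤∑ (suc N) a b 1≤a a<b b≤1+N with m≤n⇒m<n∨m≡n b≤1+N
  ... | inj₁ (s≤s b≤N) = ≤-trans (two-terms≤∑ N a b 1≤a a<b b≤N) (m≤m+n (∑ f N) (f (suc N)))
  ... | inj₂ refl = +-monoˡ-≤ (f (suc N)) (term≤∑ N a 1≤a (≤-pred a<b))

  three-terms≤∑ : ∀ N a b c → 1 ≤ a → a < b → b < c → c ≤ N → f a + f b + f c ≤ ∑ f N
  three-terms≤∑ zero _ _ _ _ _ (s≤s _) ()
  three-terms≤∑ (suc N) a b c 1≤a a<b b<c c≤1+N with m≤n⇒m<n∨m≡n c≤1+N
  ... | inj₁ (s≤s c≤N) = ≤-trans (three-terms≤∑ N a b c 1≤a a<b b<c c≤N) (m≤m+n (∑ f N) (f (suc N)))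
  ... | inj₂ refl = +-monoˡ-≤ (f (suc N)) (two-terms≤∑ N a b 1≤a a<b (≤-pred b<c))

  ∑≡0⇒term≡0 : ∀ N → ∑ f N ≡ 0 → ∀ a → 1 ≤ a → a ≤ N → f a ≡ 0
  ∑≡0⇒term≡0 N h a 1≤a a≤N = n≤0⇒n≡0 (subst (f a ≤_) h (term≤∑ N a 1≤a a≤N))

module _ (f g : ℕ → ℕ) where

  ∑-cong : ∀ N → (∀ j → 1 ≤ j → j ≤ N → f j ≡ g j) → ∑ f N ≡ ∑ g N
  ∑-cong zero _ = refl
  ∑-cong (suc N) h = cong₂ _+_ (∑-cong N (λ j 1≤j j≤N → h j 1≤j (m≤n⇒m≤1+n j≤N))) (h (suc N) (s≤s z≤n) ≤-refl)

  ∑-+ : ∀ N → ∑ (λ j → f j + g j) N ≡ ∑ f N + ∑ g N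
  ∑-+ zero = refl
  ∑-+ (suc N) = trans (cong (_+ (f (suc N) + g (suc N))) (∑-+ N))
    (interchange (∑ f N) (∑ g N) (f (suc N)) (g (suc N)))

  ∑-≤-head : ∀ N → (∀ j → 1 < j → j ≤ N → f j ≤ g j) → ∑ f N ≤ f 1 + ∑ g N
  ∑-≤-head zero _ = z≤n
  ∑-≤-head (suc zero) _ = m≤m+n (f 1) (0 + g 1)
  ∑-≤-head (suc (suc N)) h = begin
    ∑ f (suc N) + f (2 + N)
      ≤⟨ +-mono-≤ (∑-≤-head (suc N) (λ j 1<j j≤N → h j 1<j (m≤n⇒m≤1+n j≤N))) (h (2 + N) (s≤s (s≤s z≤n)) ≤-refl) ⟩
    f 1 + ∑ g (suc N) + g (2 + N)     ≡⟨ +-assoc (f 1) (∑ g (suc N)) (g (2 + N)) ⟩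
    f 1 + ∑ g (2 + N)                 ∎
    where open ≤-Reasoning

  ∑-telescope : (q : ℕ → ℕ) → ∀ N → (∀ j → 1 ≤ j → j ≤ N → f j + q (j ∸ 1) ≡ g j + q j) → ∑ f N + q 0 ≡ ∑ g N + q N
  ∑-telescope q zero _ = refl
  ∑-telescope q (suc N) h = begin
    ∑ f N + f (suc N) + q 0       ≡⟨ xy∙z≈xz∙y (∑ f N) (f (suc N)) (q 0) ⟩
    ∑ f N + q 0 + f (suc N)       ≡⟨ cong (_+ f (suc N)) (∑-telescope q N (λ j 1≤j j≤N → h j 1≤j (m≤n⇒m≤1+n j≤N))) ⟩
    ∑ g N + q N + f (suc N)       ≡⟨ +-assoc (∑ g N) (q N) (f (suc N)) ⟩
    ∑ g N + (q N + f (suc N))     ≡⟨ cong (∑ g N +_) (trans (+-comm (q N) (f (suc N))) (h (suc N) (s≤s z≤n) ≤-refl)) ⟩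
    ∑ g N + (g (suc N) + q (suc N)) ≡⟨ sym (+-assoc (∑ g N) (g (suc N)) (q (suc N))) ⟩
    ∑ g N + g (suc N) + q (suc N) ∎
    where open ≡-Reasoning

∑-1 : ∀ N → ∑ (λ _ → 1) N ≡ N
∑-1 zero = refl
∑-1 (suc N) = trans (cong (_+ 1) (∑-1 N)) (+-comm N 1)

≢false⇒true : ∀ {b} → b ≢ false → b ≡ true
≢false⇒true {true} _ = refl
≢false⇒true {false} b≢false = ⊥-elim (b≢false refl)

≢true⇒false : ∀ {b} → b ≢ true → b ≡ false
≢true⇒false {true} b≢true = ⊥-elim (b≢true refl)
≢true⇒false {false} _ = refl

true-or-false : ∀ b → b ≡ true ⊎ b ≡ false
true-or-false true = inj₁ refl
true-or-false false = inj₂ refl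

true≢false : ∀ {b} → b ≡ true → b ≡ false → ⊥
true≢false refl ()

∨-introʳ : ∀ {a b} → b ≡ true → a ∨ b ≡ true
∨-introʳ {a} b≡true = trans (cong (a ∨_) b≡true) (∨-zeroʳ a)

∧-falseʳ : ∀ {a b} → b ≡ false → a ∧ b ≡ false
∧-falseʳ {a} b≡false = trans (cong (a ∧_) b≡false) (∧-zeroʳ a)

not∧∧not-sound : ∀ a b c → not a ∧ b ∧ not c ≡ true → (a ≡ false) × (b ≡ true) × (c ≡ false)
not∧∧not-sound false true false _ = refl , refl , refl

not∧∧∧∧not-sound : ∀ a b c d e → not a ∧ b ∧ c ∧ d ∧ not e ≡ true → (b ≡ true) × (c ≡ true) × (d ≡ true)
not∧∧∧∧not-sound false true true true false _ = refl , refl , refl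

modus-ponens : ∀ {h c} → not h ∨ c ≡ true → h ≡ true → c ≡ true
modus-ponens h⇒c refl = h⇒c

≡ᵇ⇒≡′ : ∀ {a b} → (a ≡ᵇ b) ≡ true → a ≡ b
≡ᵇ⇒≡′ {a} {b} eq = ≡ᵇ⇒≡ a b (Equivalence.from T-≡ eq)

BoolFun : ℕ → Set
BoolFun zero = Bool
BoolFun (suc k) = Bool → BoolFun k

Tautology : ∀ k → BoolFun k → Set
Tautology zero b = b ≡ true
Tautology (suc k) f = ∀ x → Tautology k (f x)

tautology? : ∀ k → BoolFun k → Bool
tautology? zero b = b
tautology? (suc k) f = tautology? k (f true) ∧ tautology? k (f false)

tautology?-sound : ∀ k f → tautology? k f ≡ true → Tautology k f
tautology?-sound zero b b≡true = b≡true
tautology?-sound (suc k) f both true = tautology?-sound k (f true) (∧-conicalˡ _ _ both)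
tautology?-sound (suc k) f both false = tautology?-sound k (f false) (∧-conicalʳ _ _ both)

double : ℕ → ℕ
double zero = 0
double (suc k) = 2 + double k

double≡2* : ∀ k → double k ≡ 2 * k
double≡2* zero = refl
double≡2* (suc k) = trans (cong (2 +_) (double≡2* k)) (sym (*-suc 2 k))

double-mono-≤ : ∀ {a b} → a ≤ b → double a ≤ double b
double-mono-≤ z≤n = z≤n
double-mono-≤ (s≤s a≤b) = s≤s (s≤s (double-mono-≤ a≤b))

double-cancel-≤ : ∀ a b → double a ≤ suc (double b) → a ≤ b
double-cancel-≤ zero b _ = z≤n
double-cancel-≤ (suc a) (suc b) (s≤s (s≤s le)) = s≤s (double-cancel-≤ a b le)

even-or-odd : ∀ n → (∃ λ h → n ≡ double h) ⊎ (∃ λ h → n ≡ suc (double h))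
even-or-odd zero = inj₁ (0 , refl)
even-or-odd (suc n) with even-or-odd n
... | inj₁ (h , n≡2h) = inj₂ (h , cong suc n≡2h)
... | inj₂ (h , n≡1+2h) = inj₁ (suc h , cong suc n≡1+2h)

suc[m∸suc-d]≡m∸d : ∀ {m d} → d < m → suc (m ∸ suc d) ≡ m ∸ d
suc[m∸suc-d]≡m∸d d<m = sym (+-∸-assoc 1 d<m)

mod3-cases : ∀ j → 1 ≤ j → ∃ λ t → (j ≡ 1 + t * 3) ⊎ (j ≡ 2 + t * 3) ⊎ (j ≡ 3 + t * 3)
mod3-cases 1 _ = 0 , inj₁ refl
mod3-cases 2 _ = 0 , inj₂ (inj₁ refl)
mod3-cases 3 _ = 0 , inj₂ (inj₂ refl)
mod3-cases (suc (suc (suc (suc j)))) _ with mod3-cases (suc j) (s≤s z≤n)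
... | t , inj₁ eq = suc t , inj₁ (cong (3 +_) eq)
... | t , inj₂ (inj₁ eq) = suc t , inj₂ (inj₁ (cong (3 +_) eq))
... | t , inj₂ (inj₂ eq) = suc t , inj₂ (inj₂ (cong (3 +_) eq))

squeeze-counts : ∀ {w₂ K c w} → w₂ ≤ 2 → w ≤ 2 → w ≤ c → 2 ≤ K + w₂ → w₂ + 2 * K + 2 * c ≤ 3 * w →
  (w ≡ 2) × (c ≡ 2) × (w₂ ≡ 2) × (K ≡ 0)
squeeze-counts {w₂} {K} {c} {w} w₂≤2 w≤2 w≤c 2≤K+w₂ bound = w≡2 , c≡2 , w₂≡2 , K≡0
  where
    open ≤-Reasoning
    w₂+2K≤w : w₂ + 2 * K ≤ w
    w₂+2K≤w = +-cancelʳ-≤ (2 * w) _ _ (begin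
      w₂ + 2 * K + 2 * w  ≤⟨ +-monoʳ-≤ (w₂ + 2 * K) (*-monoʳ-≤ 2 w≤c) ⟩
      w₂ + 2 * K + 2 * c  ≤⟨ bound ⟩
      3 * w               ≡⟨ solve (w ∷ []) ⟩
      w + 2 * w           ∎)
    2+K≤w : 2 + K ≤ w
    2+K≤w = begin
      2 + K           ≤⟨ +-monoˡ-≤ K 2≤K+w₂ ⟩
      K + w₂ + K      ≡⟨ solve (K ∷ w₂ ∷ []) ⟩
      w₂ + 2 * K      ≤⟨ w₂+2K≤w ⟩
      w               ∎
    K≡0 : K ≡ 0
    K≡0 = n≤0⇒n≡0 (+-cancelˡ-≤ 2 K 0 (≤-trans 2+K≤w w≤2))
    w≡2 : w ≡ 2
    w≡2 = ≤-antisym w≤2 (≤-trans (m≤m+n 2 K) 2+K≤w)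
    w₂≡2 : w₂ ≡ 2
    w₂≡2 = ≤-antisym w₂≤2 (subst (λ k → 2 ≤ k + w₂) K≡0 2≤K+w₂)
    c≡2 : c ≡ 2
    c≡2 = ≤-antisym (*-cancelˡ-≤ 2 (+-cancelˡ-≤ 2 (2 * c) 4 (at-values w₂≡2 K≡0 w≡2 bound))) (subst (_≤ c) w≡2 w≤c)
      where
        at-values : ∀ {x k y} → x ≡ 2 → k ≡ 0 → y ≡ 2 → x + 2 * k + 2 * c ≤ 3 * y → 2 + 2 * c ≤ 2 + 4
        at-values refl refl refl h = h

pair-balance : ∀ {N Y X V U w w₂ c p K} → X + w ≡ Y + 1 → U + w₂ ≡ V + 1 → N + c ≡ 3 * Y + 2 → N + p ≡ 3 * V + K + 2 →
  3 * (Y + X) + (3 * w + 2 * p) ≡ 3 * (V + U) + (3 * w₂ + 2 * K + 2 * c)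
pair-balance {N} {Y} {X} {V} {U} {w} {w₂} {c} {p} {K} bottom-pair top-pair bottom-row top-row = +-cancelʳ-≡ 1 _ _ (begin
  3 * (Y + X) + (3 * w + 2 * p) + 1          ≡⟨ solve (Y ∷ X ∷ w ∷ p ∷ []) ⟩
  3 * Y + 3 * (X + w) + 2 * p + 1            ≡⟨ cong (λ t → 3 * Y + 3 * t + 2 * p + 1) bottom-pair ⟩
  3 * Y + 3 * (Y + 1) + 2 * p + 1            ≡⟨ solve (Y ∷ p ∷ []) ⟩
  2 * (3 * Y + 2) + 2 * p                    ≡⟨ cong (λ t → 2 * t + 2 * p) bottom-row ⟨
  2 * (N + c) + 2 * p                        ≡⟨ solve (N ∷ c ∷ p ∷ []) ⟩
  2 * (N + p) + 2 * c                        ≡⟨ cong (λ t → 2 * t + 2 * c) top-row ⟩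
  2 * (3 * V + K + 2) + 2 * c                ≡⟨ solve (V ∷ K ∷ c ∷ []) ⟩
  3 * V + 3 * (V + 1) + 2 * K + 2 * c + 1    ≡⟨ cong (λ t → 3 * V + 3 * t + 2 * K + 2 * c + 1) top-pair ⟨
  3 * V + 3 * (U + w₂) + 2 * K + 2 * c + 1   ≡⟨ solve (V ∷ U ∷ w₂ ∷ K ∷ c ∷ []) ⟩
  3 * (V + U) + (3 * w₂ + 2 * K + 2 * c) + 1 ∎)
  where open ≡-Reasoning

squeeze-pairs : ∀ {S T w w₂ K c p} → S ≤ T → 3 * S + (3 * w + 2 * p) ≡ 3 * T + (3 * w₂ + 2 * K + 2 * c) →
  p ≤ w₂ → w₂ ≤ 2 → w ≤ 2 → w ≤ c → 2 ≤ K + w₂ → (w ≡ 2) × (c ≡ 2) × (w₂ ≡ 2) × (K ≡ 0) × (S ≡ T)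
squeeze-pairs {S} {T} {w} {w₂} {K} {c} {p} S≤T balance p≤w₂ w₂≤2 w≤2 w≤c 2≤K+w₂
  with squeeze-counts w₂≤2 w≤2 w≤c 2≤K+w₂ bound
  where
    open ≤-Reasoning
    bound : w₂ + 2 * K + 2 * c ≤ 3 * w
    bound = +-cancelʳ-≤ (2 * w₂) _ _ (+-cancelˡ-≤ (3 * T) _ _ (begin
      3 * T + (w₂ + 2 * K + 2 * c + 2 * w₂)
        ≡⟨ solve (T ∷ w₂ ∷ K ∷ c ∷ []) ⟩
      3 * T + (3 * w₂ + 2 * K + 2 * c)  ≡⟨ balance ⟨
      3 * S + (3 * w + 2 * p)           ≤⟨ +-mono-≤ (*-monoʳ-≤ 3 S≤T) (+-monoʳ-≤ (3 * w) (*-monoʳ-≤ 2 p≤w₂)) ⟩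
      3 * T + (3 * w + 2 * w₂)          ∎))
... | refl , refl , refl , refl = refl , refl , refl , refl , ≤-antisym S≤T (*-cancelˡ-≤ 3 (+-cancelʳ-≤ 10 _ _ (begin
      3 * T + 10                        ≡⟨ balance ⟨
      3 * S + (6 + 2 * p)               ≤⟨ +-monoʳ-≤ (3 * S) (+-monoʳ-≤ 6 (*-monoʳ-≤ 2 p≤w₂)) ⟩
      3 * S + 10                        ∎)))
  where open ≤-Reasoning

Row101 : ℕ → Config → ℕ → Set
Row101 n C r = ∀ j → 1 ≤ j → j ≤ n → (j % 3 ≡ 2 → C r j ≡ false) × (j % 3 ≢ 2 → C r j ≡ true)

Blocks101 : ℕ → Config → ℕ → Set
Blocks101 n C r = ∀ t → (1 + t * 3 ≤ n → C r (1 + t * 3) ≡ true) × (2 + t * 3 ≤ n → C r (2 + t * 3) ≡ false) ×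
                        (3 + t * 3 ≤ n → C r (3 + t * 3) ≡ true)

blocks⇒Row101 : ∀ {n C r} → Blocks101 n C r → Row101 n C r
blocks⇒Row101 blocks j 1≤j j≤n with mod3-cases j 1≤j
... | t , inj₁ refl =
  (λ j%3≡2 → contradiction (trans (sym ([m+kn]%n≡m%n 1 t 3)) j%3≡2) λ ()) , (λ _ → proj₁ (blocks t) j≤n)
... | t , inj₂ (inj₁ refl) =
  (λ _ → proj₁ (proj₂ (blocks t)) j≤n) , (λ j%3≢2 → ⊥-elim (j%3≢2 ([m+kn]%n≡m%n 2 t 3)))
... | t , inj₂ (inj₂ refl) =
  (λ j%3≡2 → contradiction (trans (sym ([m+kn]%n≡m%n 3 t 3)) j%3≡2) λ ()) , (λ _ → proj₂ (proj₂ (blocks t)) j≤n)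

≤-steps : (f : ℕ → ℕ) {a b : ℕ} → (∀ k → a ≤ k → suc k ≤ b → f k ≤ f (suc k)) →
  ∀ {d e} → a ≤ d → d ≤ e → e ≤ b → f d ≤ f e
≤-steps f step {d} {zero} a≤d z≤n _ = ≤-refl
≤-steps f step {d} {suc e} a≤d d≤1+e 1+e≤b with m≤n⇒m<n∨m≡n d≤1+e
... | inj₂ refl = ≤-refl
... | inj₁ (s≤s d≤e) = ≤-trans (≤-steps f step a≤d d≤e (≤-trans (n≤1+n e) 1+e≤b))
                                (step e (≤-trans a≤d d≤e) 1+e≤b)

module Stable {m n : ℕ} {C : Config} (es : EvolutionaryStable m n C) where

  record Surrounded (i j : ℕ) : Set where
    field
      1<j : 1 < j
      j<n : j < n
      i<m : i < m
      west : C i (j ∸ 1) ≡ true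
      east : C i (suc j) ≡ true
      south : C (suc i) j ≡ true

  open Surrounded public

  data AltruistWitness (i j : ℕ) : Set where
    blocks-west : 2 < j → C i (j ∸ 2) ≡ true → C (suc i) (j ∸ 1) ≡ true → AltruistWitness i j
    blocks-east : suc j < n → C i (2 + j) ≡ true → C (suc i) (suc j) ≡ true → AltruistWitness i j
    blocks-north : 1 < i → C (i ∸ 1) (j ∸ 1) ≡ true → C (i ∸ 1) j ≡ true → C (i ∸ 1) (suc j) ≡ true →
                   AltruistWitness i j

  house-before-occupying : ∀ i j {i' j'} → i' ≢ i ⊎ j' ≢ j → occupy C i j i' j' ≡ true → C i' j' ≡ true
  house-before-occupying i j {i'} {j'} elsewhere occupied with i' ≟ i | j' ≟ j | elsewhere
  ... | no _ | _ | _ = occupied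
  ... | yes _ | no _ | _ = occupied
  ... | yes i'≡i | yes _ | inj₁ i'≢i = ⊥-elim (i'≢i i'≡i)
  ... | yes _ | yes j'≡j | inj₂ j'≢j = ⊥-elim (j'≢j j'≡j)

  no-blocked-house : ∀ {i j} → 1 ≤ i → i < m → 1 < j → j < n →
    C i j ≡ true → C i (j ∸ 1) ≡ true → C i (suc j) ≡ true → C (suc i) j ≡ true → ⊥
  no-blocked-house 1≤i i<m 1<j j<n c cw ce cs =
    proj₁ (proj₁ es) _ _ ((1≤i , <⇒≤ i<m) , (<⇒≤ 1<j , <⇒≤ j<n)) (c , (1<j , cw) , (j<n , ce) , (i<m , cs))

  vacant⇒surrounded : ∀ {i j} → 1 ≤ i → i ≤ m → 1 ≤ j → j ≤ n → C i j ≡ false → Surrounded i j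
  vacant⇒surrounded {i} {j} 1≤i i≤m 1≤j j≤n vacant
    with proj₁ (proj₂ es) i j (((1≤i , i≤m) , (1≤j , j≤n)) , vacant)
  ... | _ , (1<j , w) , (j<n , e) , (i<m , s) = record
    { 1<j = 1<j ; j<n = j<n ; i<m = i<m
    ; west = house-before-occupying i j (inj₂ (<⇒≢ (∸-monoʳ-< (s≤s z≤n) 1≤j))) w
    ; east = house-before-occupying i j (inj₂ 1+n≢n) e
    ; south = house-before-occupying i j (inj₁ 1+n≢n) s
    }

  private
    -- Splitting on _≟_ directly would also abstract the comparisons inside occupy.
    ≡-or-≢ : (a b : ℕ) → a ≡ b ⊎ a ≢ b
    ≡-or-≢ a b with a ≟ b
    ... | yes a≡b = inj₁ a≡b
    ... | no a≢b = inj₂ a≢b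

    -- The blocked house (i', j') is not blocked in C, so (i, j) is one of the lots it depends on.
    occupying-blocks-neighbour : ∀ {i j i' j'} → 1 ≤ i' → i' < m → 1 < j' → j' < n → ¬ (i' ≡ i × j' ≡ j) →
      occupy C i j i' j' ≡ true → occupy C i j i' (j' ∸ 1) ≡ true → occupy C i j i' (suc j') ≡ true →
      occupy C i j (suc i') j' ≡ true → AltruistWitness i j
    occupying-blocks-neighbour {i} {j} {i'} {suc j'} 1≤i' i'<m 1<j' j'<n elsewhere c cw ce cs with ≡-or-≢ i' i
    ... | inj₁ refl with ≡-or-≢ j' j | ≡-or-≢ (suc (suc j')) j
    ...   | inj₁ refl | _ = blocks-east j'<n
            (house-before-occupying i j (inj₂ (>⇒≢ (m<n⇒m<1+n (n<1+n _)))) ce) (house-before-occupying i j (inj₁ 1+n≢n) cs)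
    ...   | inj₂ _ | inj₁ refl = blocks-west (s≤s 1<j')
            (house-before-occupying i j (inj₂ (<⇒≢ (m<n⇒m<1+n (n<1+n _)))) cw) (house-before-occupying i j (inj₁ 1+n≢n) cs)
    ...   | inj₂ j'≢j | inj₂ 2+j'≢j = ⊥-elim (no-blocked-house 1≤i' i'<m 1<j' j'<n
            (house-before-occupying i j (inj₂ (λ e → elsewhere (refl , e))) c) (house-before-occupying i j (inj₂ j'≢j) cw)
            (house-before-occupying i j (inj₂ 2+j'≢j) ce) (house-before-occupying i j (inj₁ 1+n≢n) cs))
    occupying-blocks-neighbour {i} {j} {i'} {suc j'} 1≤i' i'<m 1<j' j'<n elsewhere c cw ce cs | inj₂ i'≢i
      with ≡-or-≢ (suc i') i | ≡-or-≢ (suc j') j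
    ...   | inj₁ refl | inj₁ refl = blocks-north (s≤s 1≤i') (house-before-occupying i j (inj₁ i'≢i) cw)
            (house-before-occupying i j (inj₁ i'≢i) c) (house-before-occupying i j (inj₁ i'≢i) ce)
    ...   | inj₁ _ | inj₂ j'≢j = ⊥-elim (no-blocked-house 1≤i' i'<m 1<j' j'<n (house-before-occupying i j (inj₁ i'≢i) c)
            (house-before-occupying i j (inj₁ i'≢i) cw) (house-before-occupying i j (inj₁ i'≢i) ce)
            (house-before-occupying i j (inj₂ j'≢j) cs))
    ...   | inj₂ 1+i'≢i | _ = ⊥-elim (no-blocked-house 1≤i' i'<m 1<j' j'<n (house-before-occupying i j (inj₁ i'≢i) c)
            (house-before-occupying i j (inj₁ i'≢i) cw) (house-before-occupying i j (inj₁ i'≢i) ce)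
            (house-before-occupying i j (inj₁ 1+i'≢i) cs))

  vacant⇒altruist : ∀ {i j} → 1 ≤ i → i ≤ m → 1 ≤ j → j ≤ n → C i j ≡ false → AltruistWitness i j
  vacant⇒altruist {i} {j} 1≤i i≤m 1≤j j≤n vacant
    with proj₂ (proj₂ es) i j (((1≤i , i≤m) , (1≤j , j≤n)) , vacant)
  ... | _ , _ , ((1≤i' , _) , _) , elsewhere , (c , (1<j' , cw) , (j'<n , ce) , (i'<m , cs)) =
    occupying-blocks-neighbour 1≤i' i'<m 1<j' j'<n elsewhere c cw ce cs

  west-column : ∀ {i} → 1 ≤ i → i ≤ m → 1 ≤ n → C i 1 ≡ true
  west-column 1≤i i≤m 1≤n = ≢false⇒true λ vacant → <-irrefl refl (1<j (vacant⇒surrounded 1≤i i≤m ≤-refl 1≤n vacant))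

  east-column : ∀ {i} → 1 ≤ i → i ≤ m → 1 ≤ n → C i n ≡ true
  east-column 1≤i i≤m 1≤n = ≢false⇒true λ vacant → <-irrefl refl (j<n (vacant⇒surrounded 1≤i i≤m 1≤n ≤-refl vacant))

  bottom-row : ∀ {j} → 1 ≤ m → 1 ≤ j → j ≤ n → C m j ≡ true
  bottom-row 1≤m 1≤j j≤n = ≢false⇒true λ vacant → <-irrefl refl (i<m (vacant⇒surrounded 1≤m ≤-refl 1≤j j≤n vacant))

  house-above-vacant : ∀ {i j} → 1 ≤ i → i < m → 1 ≤ j → j ≤ n → C (suc i) j ≡ false → C i j ≡ true
  house-above-vacant 1≤i i<m 1≤j j≤n below = ≢false⇒true λ vacant →
    true≢false (south (vacant⇒surrounded 1≤i (<⇒≤ i<m) 1≤j j≤n vacant)) below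

  no-four-in-a-row : ∀ {i j} → 1 ≤ i → i < m → 1 ≤ j → 3 + j ≤ n →
    C i j ≡ true → C i (1 + j) ≡ true → C i (2 + j) ≡ true → C i (3 + j) ≡ true → ⊥
  no-four-in-a-row {i} {j} 1≤i i<m 1≤j 3+j≤n c₀ c₁ c₂ c₃ with C (suc i) (suc j) in below
  ... | true = no-blocked-house 1≤i i<m (s≤s 1≤j) (≤-trans (s≤s (s≤s (n≤1+n j))) 3+j≤n) c₁ c₀ c₂ below
  ... | false = no-blocked-house 1≤i i<m (s≤s (s≤s z≤n)) 3+j≤n c₂ c₁ c₃
    (east (vacant⇒surrounded (s≤s z≤n) i<m (s≤s z≤n) (≤-trans (n≤1+n _) (≤-trans (n≤1+n _) 3+j≤n)) below))

module Wide (m₀ n₀ : ℕ) {C : Config} (es : EvolutionaryStable (3 + m₀) (4 + n₀) C) where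

  M N : ℕ
  M = 3 + m₀
  N = 4 + n₀

  open Stable es

  west-wall : ∀ {r} → 1 ≤ r → r ≤ M → C r 1 ≡ true
  west-wall 1≤r r≤M = west-column 1≤r r≤M (s≤s z≤n)

  east-wall : ∀ {r} → 1 ≤ r → r ≤ M → C r N ≡ true
  east-wall 1≤r r≤M = east-column 1≤r r≤M (s≤s z≤n)

  opaque
    inRange : ℕ → Bool
    inRange x = (1 ≤ᵇ x) ∧ (x ≤ᵇ N)

    house vacant : ℕ → ℕ → Bool
    house r x = inRange x ∧ C r x
    vacant r x = inRange x ∧ not (C r x)

    inRange-true : ∀ {x} → 1 ≤ x → x ≤ N → inRange x ≡ true
    inRange-true 1≤x x≤N = cong₂ _∧_ (Equivalence.to T-≡ (≤⇒≤ᵇ 1≤x)) (Equivalence.to T-≡ (≤⇒≤ᵇ x≤N))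

    inRange-sound : ∀ {x} → inRange x ≡ true → (1 ≤ x) × (x ≤ N)
    inRange-sound {x} both =
      ≤ᵇ⇒≤ 1 x (Equivalence.from T-≡ (∧-conicalˡ _ _ both)) , ≤ᵇ⇒≤ x N (Equivalence.from T-≡ (∧-conicalʳ _ _ both))

    house-beyond : ∀ r → house r (suc N) ≡ false
    house-beyond r with suc N ≤ᵇ N in eq
    ... | true = ⊥-elim (<-irrefl refl (≤ᵇ⇒≤ (suc N) N (Equivalence.from T-≡ eq)))
    ... | false = refl

    house-true : ∀ {r x} → 1 ≤ x → x ≤ N → C r x ≡ true → house r x ≡ true
    house-true 1≤x x≤N c = cong₂ _∧_ (inRange-true 1≤x x≤N) c

    house-false : ∀ {r x} → C r x ≡ false → house r x ≡ false
    house-false c = ∧-falseʳ c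

    house-sound : ∀ {r x} → house r x ≡ true → (1 ≤ x) × (x ≤ N) × (C r x ≡ true)
    house-sound h = let (1≤x , x≤N) = inRange-sound (∧-conicalˡ _ _ h) in 1≤x , x≤N , ∧-conicalʳ _ _ h

    vacant-true : ∀ {r x} → 1 ≤ x → x ≤ N → C r x ≡ false → vacant r x ≡ true
    vacant-true 1≤x x≤N c = cong₂ _∧_ (inRange-true 1≤x x≤N) (cong not c)

    vacant-false : ∀ {r x} → C r x ≡ true → vacant r x ≡ false
    vacant-false c = ∧-falseʳ (cong not c)

    vacant-sound : ∀ {r x} → vacant r x ≡ true → (1 ≤ x) × (x ≤ N) × (C r x ≡ false)
    vacant-sound v = let (1≤x , x≤N) = inRange-sound (∧-conicalˡ _ _ v) in 1≤x , x≤N , not-injective (∧-conicalʳ _ _ v)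

    not-house≡vacant : ∀ {r x} → 1 ≤ x → x ≤ N → not (house r x) ≡ vacant r x
    not-house≡vacant 1≤x x≤N rewrite inRange-true 1≤x x≤N = refl

    not-vacant⇒house : ∀ {r x} → 1 ≤ x → x ≤ N → vacant r x ≡ false → C r x ≡ true
    not-vacant⇒house {r} {x} 1≤x x≤N v rewrite inRange-true 1≤x x≤N = trans (sym (not-involutive (C r x))) (cong not v)

    not-house⇒vacant : ∀ {r x} → 1 ≤ x → x ≤ N → house r x ≡ false → C r x ≡ false
    not-house⇒vacant 1≤x x≤N h rewrite inRange-true 1≤x x≤N = h

    house-zero : ∀ r → house r 0 ≡ false
    house-zero r = refl

    vacant-zero : ∀ r → vacant r 0 ≡ false
    vacant-zero r = refl

  house-in-every-pair : ∀ {r} → 1 ≤ r → r ≤ M → ∀ x → x ≤ N → house r x ∨ house r (suc x) ≡ true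
  house-in-every-pair {r} 1≤r r≤M zero _ =
    trans (cong (_∨ house r 1) (house-zero r)) (house-true ≤-refl (s≤s z≤n) (west-wall 1≤r r≤M))
  house-in-every-pair {r} 1≤r r≤M (suc x) x<N with true-or-false (C r (suc x))
  ... | inj₁ c = cong (_∨ house r (2 + x)) (house-true (s≤s z≤n) x<N c)
  ... | inj₂ c = ∨-introʳ (house-true (s≤s z≤n) (j<n s) (east s))
    where s = vacant⇒surrounded 1≤r r≤M (s≤s z≤n) x<N c

  no-four-houses : ∀ {r} → 1 ≤ r → r < M → ∀ x →
    house r (x ∸ 2) ∧ house r (x ∸ 1) ∧ house r x ∧ house r (suc x) ≡ false
  no-four-houses {r} 1≤r r<M 0 rewrite house-zero r = refl
  no-four-houses {r} 1≤r r<M 1 rewrite house-zero r = refl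
  no-four-houses {r} 1≤r r<M (suc (suc x))
    with house r x in h₀ | house r (1 + x) in h₁ | house r (2 + x) in h₂ | house r (3 + x) in h₃
  ... | true | true | true | true = ⊥-elim (no-four-in-a-row 1≤r r<M
          (proj₁ (house-sound h₀)) (proj₁ (proj₂ (house-sound h₃)))
          (proj₂ (proj₂ (house-sound h₀))) (proj₂ (proj₂ (house-sound h₁)))
          (proj₂ (proj₂ (house-sound h₂))) (proj₂ (proj₂ (house-sound h₃))))
  ... | false | _ | _ | _ = refl
  ... | true | false | _ | _ = refl
  ... | true | true | false | _ = refl
  ... | true | true | true | false = refl

  singleton triple : ℕ → ℕ → Bool
  singleton r x = not (house r (x ∸ 1)) ∧ house r x ∧ not (house r (suc x))
  triple r x = not (house r (x ∸ 2)) ∧ house r (x ∸ 1) ∧ house r x ∧ house r (suc x) ∧ not (house r (2 + x))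

  singleton-intro : ∀ {r x} → house r (x ∸ 1) ≡ false → house r x ≡ true → house r (suc x) ≡ false →
    singleton r x ≡ true
  singleton-intro h₋₁ h₀ h₁ rewrite h₋₁ | h₀ | h₁ = refl

  triple-intro : ∀ {r x} → house r (x ∸ 2) ≡ false → house r (x ∸ 1) ≡ true → house r x ≡ true →
    house r (suc x) ≡ true → house r (2 + x) ≡ false → triple r x ≡ true
  triple-intro h₋₂ h₋₁ h₀ h₁ h₂ rewrite h₋₂ | h₋₁ | h₀ | h₁ | h₂ = refl

  singletons triples vacancies wallVacancies : ℕ → ℕ
  singletons r = ∑ (λ x → ⟦ singleton r x ⟧) N
  triples r = ∑ (λ x → ⟦ triple r x ⟧) N
  vacancies r = ∑ (λ x → ⟦ vacant r x ⟧) N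
  wallVacancies r = ⟦ vacant r 2 ⟧ + ⟦ vacant r (3 + n₀) ⟧

  -- Along a run of houses, runSurplus h₋₂ h₋₁ h₀ h₊₁ is the excess of the left-hand over the
  -- right-hand side of the row identity accumulated so far (runs have length 1, 2 or 3).
  runSurplus : Bool → Bool → Bool → Bool → ℕ
  runSurplus h₋₂ h₋₁ h₀ h₊₁ =
    if not h₀ then 0 else
    if not h₋₁ then (if not h₊₁ then 2 else 1) else
    if not h₋₂ then (if not h₊₁ then 2 else 1) else 2

  private
    runs-short : Bool → Bool → Bool → Bool → Bool → Bool → Bool
    runs-short h₀ h₁ h₂ h₃ h₄ h₅ = (h₂ ∨ h₃) ∧ (h₃ ∨ h₄) ∧
      not (h₀ ∧ h₁ ∧ h₂ ∧ h₃) ∧ not (h₁ ∧ h₂ ∧ h₃ ∧ h₄) ∧ not (h₂ ∧ h₃ ∧ h₄ ∧ h₅)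

    runSurplus-step : Tautology 6 λ h₀ h₁ h₂ h₃ h₄ h₅ → not (runs-short h₀ h₁ h₂ h₃ h₄ h₅) ∨
      (1 + ⟦ not h₂ ∧ h₃ ∧ not h₄ ⟧ + runSurplus h₀ h₁ h₂ h₃ ≡ᵇ
       3 * ⟦ not h₃ ⟧ + ⟦ not h₁ ∧ h₂ ∧ h₃ ∧ h₄ ∧ not h₅ ⟧ + runSurplus h₁ h₂ h₃ h₄)
    runSurplus-step = tautology?-sound 6 _ refl

  surplus : ℕ → ℕ → ℕ
  surplus r x = runSurplus (house r (x ∸ 2)) (house r (x ∸ 1)) (house r x) (house r (suc x))

  row-balance : ∀ {r} → 1 ≤ r → r < M → ∀ j → 1 ≤ j → j ≤ N →
    1 + ⟦ singleton r j ⟧ + surplus r (j ∸ 1) ≡ 3 * ⟦ not (house r j) ⟧ + ⟦ triple r j ⟧ + surplus r j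
  row-balance {r} 1≤r r<M (suc j) _ j<N = ≡ᵇ⇒≡′ (modus-ponens (runSurplus-step h₀ h₁ h₂ h₃ h₄ h₅)
    (cong₂ _∧_ (house-in-every-pair 1≤r r≤M j (<⇒≤ j<N)) (cong₂ _∧_ (house-in-every-pair 1≤r r≤M (suc j) j<N)
      (cong₂ _∧_ (cong not (no-four-houses 1≤r r<M j)) (cong₂ _∧_ (cong not (no-four-houses 1≤r r<M (suc j)))
        (cong not (no-four-houses 1≤r r<M (2 + j))))))))
    where
      r≤M = <⇒≤ r<M
      h₀ = house r (j ∸ 2)
      h₁ = house r (j ∸ 1)
      h₂ = house r j
      h₃ = house r (1 + j)
      h₄ = house r (2 + j)
      h₅ = house r (3 + j)

  row-identity : ∀ {r} → 1 ≤ r → r < M → N + singletons r ≡ 3 * vacancies r + triples r + 2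
  row-identity {r} 1≤r r<M = begin
    N + singletons r                                      ≡⟨ cong (_+ singletons r) (∑-1 N) ⟨
    ∑ (λ _ → 1) N + singletons r                          ≡⟨ ∑-+ (λ _ → 1) _ N ⟨
    ∑ (λ x → 1 + ⟦ singleton r x ⟧) N                      ≡⟨ +-identityʳ _ ⟨
    ∑ (λ x → 1 + ⟦ singleton r x ⟧) N + 0                  ≡⟨ cong (∑ (λ x → 1 + ⟦ singleton r x ⟧) N +_) first-surplus ⟨
    ∑ (λ x → 1 + ⟦ singleton r x ⟧) N + surplus r 0        ≡⟨ ∑-telescope _ _ (surplus r) N (row-balance 1≤r r<M) ⟩
    ∑ (λ x → 3 * ⟦ not (house r x) ⟧ + ⟦ triple r x ⟧) N + surplus r N
                                                          ≡⟨ cong₂ _+_ (∑-+ _ _ N) last-surplus ⟩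
    ∑ (λ x → 3 * ⟦ not (house r x) ⟧) N + triples r + 2    ≡⟨ cong (λ s → s + triples r + 2) (∑-*ˡ _ 3 N) ⟩
    3 * ∑ (λ x → ⟦ not (house r x) ⟧) N + triples r + 2    ≡⟨ cong (λ s → 3 * s + triples r + 2) not-house-count ⟩
    3 * vacancies r + triples r + 2                       ∎
    where
      open ≡-Reasoning
      first-surplus : surplus r 0 ≡ 0
      first-surplus rewrite house-zero r = refl
      last-surplus : surplus r N ≡ 2
      last-surplus rewrite house-true {r} (s≤s z≤n) ≤-refl (east-wall 1≤r (<⇒≤ r<M)) | house-beyond r
        with house r (N ∸ 2) | house r (N ∸ 1)
      ... | true | true = refl
      ... | true | false = refl
      ... | false | true = refl
      ... | false | false = refl
      not-house-count : ∑ (λ x → ⟦ not (house r x) ⟧) N ≡ vacancies r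
      not-house-count = ∑-cong _ _ N λ x 1≤x x≤N → cong ⟦_⟧ (not-house≡vacant 1≤x x≤N)

  vacancy-pair⇒west-blocked : ∀ {a y} → 1 ≤ a → a < M → 1 ≤ y → 2 + y ≤ N →
    C a y ≡ false → C a (2 + y) ≡ false → (2 < y) × (C (suc a) (y ∸ 1) ≡ true)
  vacancy-pair⇒west-blocked {a} {y} 1≤a a<M 1≤y 2+y≤N v₀ v₂
    with vacant⇒altruist 1≤a (<⇒≤ a<M) 1≤y y≤N v₀
    where y≤N = ≤-trans (n≤1+n y) (≤-trans (n≤1+n (suc y)) 2+y≤N)
  ... | blocks-west 2<y _ below = 2<y , below
  ... | blocks-east _ h _ = ⊥-elim (true≢false h v₂)
  ... | blocks-north (s≤s 1≤a') _ n₀ n₁ = ⊥-elim (no-blocked-house 1≤a' (<⇒≤ a<M) (s≤s 1≤y)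
          (≤-trans (n≤1+n (2 + y)) (j<n s₂)) n₁ n₀
          (house-above-vacant 1≤a' (<⇒≤ a<M) (s≤s z≤n) 2+y≤N v₂) (east s₀))
    where
      s₀ = vacant⇒surrounded 1≤a (<⇒≤ a<M) 1≤y (≤-trans (n≤1+n y) (≤-trans (n≤1+n (suc y)) 2+y≤N)) v₀
      s₂ = vacant⇒surrounded 1≤a (<⇒≤ a<M) (s≤s z≤n) 2+y≤N v₂

  upper-vacancy⇒lower-vacancy-before : ∀ {a y} → 1 ≤ a → suc a < M → 4 + y ≤ N → C a (4 + y) ≡ false →
    C (suc a) (3 + y) ≡ false ⊎ C (suc a) (2 + y) ≡ false
  upper-vacancy⇒lower-vacancy-before {a} {y} 1≤a b<M 4+y≤N v₄
    with true-or-false (C (suc a) (3 + y)) | true-or-false (C (suc a) (2 + y))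
  ... | inj₂ v | _ = inj₁ v
  ... | inj₁ _ | inj₂ v = inj₂ v
  ... | inj₁ b₃ | inj₁ b₂ with true-or-false (C (suc a) (1 + y))
  ...   | inj₁ b₁ = ⊥-elim (no-four-in-a-row (s≤s z≤n) b<M (s≤s z≤n) 4+y≤N b₁ b₂ b₃ (south s₄))
    where a<M = ≤-trans (n≤1+n _) b<M
          s₄ = vacant⇒surrounded 1≤a (<⇒≤ a<M) (s≤s z≤n) 4+y≤N v₄
  ...   | inj₂ v₁ with true-or-false (C a (2 + y))
  ...     | inj₁ a₂ = ⊥-elim (no-blocked-house 1≤a a<M (s≤s (s≤s z≤n)) (≤-trans (n≤1+n _) 4+y≤N) a₂
              (house-above-vacant 1≤a a<M (s≤s z≤n) (≤-trans (m≤n+m _ 3) 4+y≤N) v₁) (west s₄) b₂)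
    where a<M = ≤-trans (n≤1+n _) b<M
          s₄ = vacant⇒surrounded 1≤a (<⇒≤ a<M) (s≤s z≤n) 4+y≤N v₄
  ...     | inj₂ v₂ = ⊥-elim (true≢false b₁ v₁)
    where b₁ = proj₂ (vacancy-pair⇒west-blocked 1≤a (≤-trans (n≤1+n _) b<M) (s≤s z≤n) 4+y≤N v₂ v₄)

  lower-vacancy⇒upper-vacancy-before : ∀ {a y} → 1 ≤ a → suc a < M → 3 + y ≤ N → C (suc a) (3 + y) ≡ false →
    C a (2 + y) ≡ false ⊎ C a (1 + y) ≡ false
  lower-vacancy⇒upper-vacancy-before {a} {y} 1≤a b<M 3+y≤N v₃
    with true-or-false (C a (2 + y)) | true-or-false (C a (1 + y))
  ... | inj₂ v | _ = inj₁ v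
  ... | inj₁ _ | inj₂ v = inj₂ v
  ... | inj₁ a₂ | inj₁ a₁ = ⊥-elim (no-blocked-house 1≤a a<M (s≤s (s≤s z≤n)) 3+y≤N a₂ a₁
          (house-above-vacant 1≤a a<M (s≤s z≤n) 3+y≤N v₃) (west s₃))
    where a<M = ≤-trans (n≤1+n _) b<M
          s₃ = vacant⇒surrounded (s≤s z≤n) (<⇒≤ b<M) (s≤s z≤n) 3+y≤N v₃

  data VacancyIn3Columns (a y : ℕ) : Set where
    upper₃ : C a (3 + y) ≡ false → VacancyIn3Columns a y
    lower₃ : C (suc a) (3 + y) ≡ false → VacancyIn3Columns a y
    upper₂ : C a (2 + y) ≡ false → VacancyIn3Columns a y
    lower₂ : C (suc a) (2 + y) ≡ false → VacancyIn3Columns a y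
    upper₁ : C a (1 + y) ≡ false → VacancyIn3Columns a y
    lower₁ : C (suc a) (1 + y) ≡ false → VacancyIn3Columns a y

  vacancy-in-3-columns : ∀ {a y} → 1 ≤ a → suc a < M → 3 + y ≤ N → VacancyIn3Columns a y
  vacancy-in-3-columns {a} {y} 1≤a b<M 3+y≤N
    with true-or-false (C a (3 + y)) | true-or-false (C (suc a) (3 + y)) | true-or-false (C a (2 + y))
       | true-or-false (C (suc a) (2 + y)) | true-or-false (C a (1 + y)) | true-or-false (C (suc a) (1 + y))
  ... | inj₂ v | _ | _ | _ | _ | _ = upper₃ v
  ... | inj₁ _ | inj₂ v | _ | _ | _ | _ = lower₃ v
  ... | inj₁ _ | inj₁ _ | inj₂ v | _ | _ | _ = upper₂ v
  ... | inj₁ _ | inj₁ _ | inj₁ _ | inj₂ v | _ | _ = lower₂ v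
  ... | inj₁ _ | inj₁ _ | inj₁ _ | inj₁ _ | inj₂ v | _ = upper₁ v
  ... | inj₁ _ | inj₁ _ | inj₁ _ | inj₁ _ | inj₁ _ | inj₂ v = lower₁ v
  ... | inj₁ a₃ | inj₁ b₃ | inj₁ a₂ | inj₁ b₂ | inj₁ a₁ | inj₁ b₁ with m≤n⇒m<n∨m≡n 3+y≤N
  ...   | inj₂ 3+y≡N = ⊥-elim (no-blocked-house 1≤a a<M (s≤s (s≤s z≤n)) (≤-reflexive 3+y≡N) a₂ a₁ a₃ b₂)
    where a<M = ≤-trans (n≤1+n _) b<M
  ...   | inj₁ 3+y<N with true-or-false (C (suc a) (4 + y))
  ...     | inj₁ b₄ = ⊥-elim (no-four-in-a-row (s≤s z≤n) b<M (s≤s z≤n) 3+y<N b₁ b₂ b₃ b₄)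
  ...     | inj₂ v₄ = ⊥-elim (no-blocked-house 1≤a a<M (s≤s (s≤s z≤n)) 3+y<N a₃ a₂
              (house-above-vacant 1≤a a<M (s≤s z≤n) 3+y<N v₄) b₃)
    where a<M = ≤-trans (n≤1+n _) b<M

  no-vertical-vacancies : ∀ {a} → 1 ≤ a → a < M → ∀ x → vacant a x ∧ vacant (suc a) x ≡ false
  no-vertical-vacancies {a} 1≤a a<M x with true-or-false (vacant a x)
  ... | inj₂ v = cong (_∧ vacant (suc a) x) v
  ... | inj₁ v = let (1≤x , x≤N , c) = vacant-sound v in
    ∧-falseʳ (vacant-false (south (vacant⇒surrounded 1≤a (<⇒≤ a<M) 1≤x x≤N c)))

  no-adjacent-vacancies : ∀ {r} → 1 ≤ r → r ≤ M → ∀ x → vacant r (suc x) ∧ vacant r x ≡ false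
  no-adjacent-vacancies {r} 1≤r r≤M x with true-or-false (vacant r x)
  ... | inj₂ v = ∧-falseʳ v
  ... | inj₁ v = let (1≤x , x≤N , c) = vacant-sound v in
    cong (_∧ vacant r x) (vacant-false (east (vacant⇒surrounded 1≤r r≤M 1≤x x≤N c)))

  no-adjacent-vacancies-before : ∀ {r} → 1 ≤ r → r ≤ M → ∀ x d → vacant r (x ∸ d) ∧ vacant r (x ∸ suc d) ≡ false
  no-adjacent-vacancies-before {r} 1≤r r≤M zero zero rewrite vacant-zero r = refl
  no-adjacent-vacancies-before {r} 1≤r r≤M zero (suc d) rewrite vacant-zero r = refl
  no-adjacent-vacancies-before 1≤r r≤M (suc x) zero = no-adjacent-vacancies 1≤r r≤M x
  no-adjacent-vacancies-before 1≤r r≤M (suc x) (suc d) = no-adjacent-vacancies-before 1≤r r≤M x d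

  module ConsecutiveRows {a} (1≤a : 1 ≤ a) (b<M : suc a < M) where

    b : ℕ
    b = suc a

    a<M : a < M
    a<M = ≤-trans (n≤1+n _) b<M

    a≤M : a ≤ M
    a≤M = <⇒≤ a<M

    b≤M : b ≤ M
    b≤M = <⇒≤ b<M

    -- In the next three lemmas the final disjunct covers the first vacancy of the two rows.
    upper-after-lower : ∀ j → suc j ≤ N →
      not (vacant a (suc j)) ∨ vacant b j ∨ vacant b (j ∸ 1) ∨
      (not (vacant b 2) ∧ not (vacant a (j ∸ 1)) ∧ not (vacant b (j ∸ 1)) ∧ not (vacant a (j ∸ 2)) ∧ not (vacant b (j ∸ 2)))
      ≡ true
    upper-after-lower 0 _ rewrite vacant-false {a} (west-wall 1≤a a≤M) = refl
    upper-after-lower 1 2≤N with true-or-false (C a 2)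
    ... | inj₁ h rewrite vacant-false h = refl
    ... | inj₂ v rewrite vacant-true {a} (s≤s z≤n) 2≤N v | vacant-false {b} (west-wall (s≤s z≤n) b≤M)
                       | vacant-false (south (vacant⇒surrounded 1≤a a≤M (s≤s z≤n) 2≤N v)) | vacant-zero a | vacant-zero b = refl
    upper-after-lower 2 _ with true-or-false (vacant b 2)
    ... | inj₁ v rewrite v = ∨-introʳ {not (vacant a 3)} refl
    ... | inj₂ v rewrite v | vacant-false {a} (west-wall 1≤a a≤M) | vacant-false {b} (west-wall (s≤s z≤n) b≤M)
                       | vacant-zero a | vacant-zero b = ∨-introʳ {not (vacant a 3)} refl
    upper-after-lower (suc (suc (suc y))) 4+y≤N with true-or-false (vacant a (4 + y))
    ... | inj₂ v rewrite v = refl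
    ... | inj₁ v with upper-vacancy⇒lower-vacancy-before 1≤a b<M 4+y≤N (proj₂ (proj₂ (vacant-sound v)))
    ...   | inj₁ v₃ rewrite v | vacant-true {b} (s≤s z≤n) (≤-trans (n≤1+n _) 4+y≤N) v₃ = refl
    ...   | inj₂ v₂ rewrite v | vacant-true {b} (s≤s z≤n) (≤-trans (n≤1+n _) (≤-trans (n≤1+n _) 4+y≤N)) v₂ =
            ∨-introʳ {vacant b (3 + y)} refl

    lower-after-upper : ∀ j → suc j ≤ N →
      not (vacant b (suc j)) ∨ vacant a j ∨ vacant a (j ∸ 1) ∨
      (vacant b 2 ∧ not (vacant a j) ∧ not (vacant b j) ∧ not (vacant a (j ∸ 1)) ∧ not (vacant b (j ∸ 1)) ∧
       not (vacant a (j ∸ 2)) ∧ not (vacant b (j ∸ 2)))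
      ≡ true
    lower-after-upper 0 _ rewrite vacant-false {b} (west-wall (s≤s z≤n) b≤M) = refl
    lower-after-upper 1 _ with true-or-false (vacant b 2)
    ... | inj₂ v rewrite v = refl
    ... | inj₁ v rewrite v | vacant-false {a} (west-wall 1≤a a≤M) | vacant-false {b} (west-wall (s≤s z≤n) b≤M)
                       | vacant-zero a | vacant-zero b = refl
    lower-after-upper (suc (suc y)) 3+y≤N with true-or-false (vacant b (3 + y))
    ... | inj₂ v rewrite v = refl
    ... | inj₁ v with lower-vacancy⇒upper-vacancy-before 1≤a b<M 3+y≤N (proj₂ (proj₂ (vacant-sound v)))
    ...   | inj₁ v₂ rewrite v | vacant-true {a} (s≤s z≤n) (≤-trans (n≤1+n _) 3+y≤N) v₂ = refl
    ...   | inj₂ v₁ rewrite v | vacant-true {a} (s≤s z≤n) (≤-trans (n≤1+n _) (≤-trans (n≤1+n _) 3+y≤N)) v₁ =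
            ∨-introʳ {vacant a (2 + y)} refl

    vacancy-dense : ∀ j → suc j ≤ N →
      vacant a (suc j) ∨ vacant b (suc j) ∨ vacant a j ∨ vacant b j ∨ vacant a (j ∸ 1) ∨ vacant b (j ∸ 1) ∨
      (not (vacant a j) ∧ not (vacant b j) ∧ not (vacant a (j ∸ 1)) ∧ not (vacant b (j ∸ 1)) ∧
       not (vacant a (j ∸ 2)) ∧ not (vacant b (j ∸ 2)))
      ≡ true
    vacancy-dense 0 _ rewrite vacant-false {a} (west-wall 1≤a a≤M) | vacant-false {b} (west-wall (s≤s z≤n) b≤M)
                            | vacant-zero a | vacant-zero b = refl
    vacancy-dense 1 _ rewrite vacant-false {a} (west-wall 1≤a a≤M) | vacant-false {b} (west-wall (s≤s z≤n) b≤M)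
                            | vacant-zero a | vacant-zero b = ∨-introʳ {vacant a 2} (∨-introʳ {vacant b 2} refl)
    vacancy-dense (suc (suc y)) 3+y≤N with vacancy-in-3-columns 1≤a b<M 3+y≤N
    ... | upper₃ v rewrite vacant-true {a} (s≤s z≤n) 3+y≤N v = refl
    ... | lower₃ v rewrite vacant-true {b} (s≤s z≤n) 3+y≤N v = ∨-introʳ {vacant a (3 + y)} refl
    ... | upper₂ v rewrite vacant-true {a} (s≤s z≤n) (≤-trans (n≤1+n _) 3+y≤N) v =
          ∨-introʳ {vacant a (3 + y)} (∨-introʳ {vacant b (3 + y)} refl)
    ... | lower₂ v rewrite vacant-true {b} (s≤s z≤n) (≤-trans (n≤1+n _) 3+y≤N) v =
          ∨-introʳ {vacant a (3 + y)} (∨-introʳ {vacant b (3 + y)} (∨-introʳ {vacant a (2 + y)} refl))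
    ... | upper₁ v rewrite vacant-true {a} (s≤s z≤n) (≤-trans (n≤1+n _) (≤-trans (n≤1+n _) 3+y≤N)) v =
          ∨-introʳ {vacant a (3 + y)} (∨-introʳ {vacant b (3 + y)} (∨-introʳ {vacant a (2 + y)} (∨-introʳ {vacant b (2 + y)} refl)))
    ... | lower₁ v rewrite vacant-true {b} (s≤s z≤n) (≤-trans (n≤1+n _) (≤-trans (n≤1+n _) 3+y≤N)) v =
          ∨-introʳ {vacant a (3 + y)} (∨-introʳ {vacant b (3 + y)} (∨-introʳ {vacant a (2 + y)} (∨-introʳ {vacant b (2 + y)}
            (∨-introʳ {vacant a (1 + y)} refl))))

    latest : Bool → Bool → Bool → Bool → Bool → Bool → Bool → Bool
    latest u₀ l₀ u₁ l₁ u₂ l₂ before =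
      if u₀ then true else if l₀ then false else
      if u₁ then true else if l₁ then false else
      if u₂ then true else if l₂ then false else before

    -- latestUpper x: the latest vacancy of the two rows in columns ≤ x is in the upper row, where a
    -- virtual upper vacancy in column 0 is assumed iff the lower row is vacant in column 2. Vacancies
    -- alternate between the rows and every three columns contain one, so columns x-2 … x decide it.
    latestUpper : ℕ → Bool
    latestUpper x = latest (vacant a x) (vacant b x) (vacant a (x ∸ 1)) (vacant b (x ∸ 1))
                           (vacant a (x ∸ 2)) (vacant b (x ∸ 2)) (vacant b 2)

    private
      alternating : Bool → Bool → Bool → Bool → Bool → Bool → Bool → Bool → Bool → Bool
      alternating u₀ u₁ u₂ u₃ l₀ l₁ l₂ l₃ F =
        not (u₀ ∧ l₀) ∧ not (u₁ ∧ l₁) ∧ not (u₂ ∧ l₂) ∧ not (u₃ ∧ l₃) ∧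
        not (u₀ ∧ u₁) ∧ not (u₁ ∧ u₂) ∧ not (u₂ ∧ u₃) ∧
        not (l₀ ∧ l₁) ∧ not (l₁ ∧ l₂) ∧ not (l₂ ∧ l₃) ∧
        (not u₀ ∨ l₁ ∨ l₂ ∨ (not F ∧ not u₂ ∧ not l₂ ∧ not u₃ ∧ not l₃)) ∧
        (not l₀ ∨ u₁ ∨ u₂ ∨ (F ∧ not u₁ ∧ not l₁ ∧ not u₂ ∧ not l₂ ∧ not u₃ ∧ not l₃)) ∧
        (u₀ ∨ l₀ ∨ u₁ ∨ l₁ ∨ u₂ ∨ l₂ ∨ (not u₁ ∧ not l₁ ∧ not u₂ ∧ not l₂ ∧ not u₃ ∧ not l₃))

      latest-step : Tautology 9 λ u₀ u₁ u₂ u₃ l₀ l₁ l₂ l₃ F → not (alternating u₀ u₁ u₂ u₃ l₀ l₁ l₂ l₃ F) ∨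
        (⟦ u₀ ⟧ + ⟦ latest u₁ l₁ u₂ l₂ u₃ l₃ F ⟧ ≡ᵇ ⟦ l₀ ⟧ + ⟦ latest u₀ l₀ u₁ l₁ u₂ l₂ F ⟧)
      latest-step = tautology?-sound 9 _ refl

    latest-balance : ∀ j → 1 ≤ j → j ≤ N →
      ⟦ vacant a j ⟧ + ⟦ latestUpper (j ∸ 1) ⟧ ≡ ⟦ vacant b j ⟧ + ⟦ latestUpper j ⟧
    latest-balance (suc j) _ j<N = ≡ᵇ⇒≡′ (modus-ponens (latest-step u₀ u₁ u₂ u₃ l₀ l₁ l₂ l₃ (vacant b 2))
      (cong₂ _∧_ (cong not (no-vertical-vacancies 1≤a a<M (suc j)))
      (cong₂ _∧_ (cong not (no-vertical-vacancies 1≤a a<M j))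
      (cong₂ _∧_ (cong not (no-vertical-vacancies 1≤a a<M (j ∸ 1)))
      (cong₂ _∧_ (cong not (no-vertical-vacancies 1≤a a<M (j ∸ 2)))
      (cong₂ _∧_ (cong not (no-adjacent-vacancies 1≤a a≤M j))
      (cong₂ _∧_ (cong not (no-adjacent-vacancies-before 1≤a a≤M j 0))
      (cong₂ _∧_ (cong not (no-adjacent-vacancies-before 1≤a a≤M j 1))
      (cong₂ _∧_ (cong not (no-adjacent-vacancies (s≤s z≤n) b≤M j))
      (cong₂ _∧_ (cong not (no-adjacent-vacancies-before (s≤s z≤n) b≤M j 0))
      (cong₂ _∧_ (cong not (no-adjacent-vacancies-before (s≤s z≤n) b≤M j 1))
      (cong₂ _∧_ (upper-after-lower j j<N)
      (cong₂ _∧_ (lower-after-upper j j<N) (vacancy-dense j j<N))))))))))))))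
      where
        u₀ = vacant a (suc j)
        u₁ = vacant a j
        u₂ = vacant a (j ∸ 1)
        u₃ = vacant a (j ∸ 2)
        l₀ = vacant b (suc j)
        l₁ = vacant b j
        l₂ = vacant b (j ∸ 1)
        l₃ = vacant b (j ∸ 2)

    vacant-before-last-house-pair : vacant a (3 + n₀) ≡ false → vacant b (3 + n₀) ≡ false → vacant a (2 + n₀) ≡ true
    vacant-before-last-house-pair u l = vacant-true (s≤s z≤n) (≤-trans (n≤1+n _) (n≤1+n _)) (≢true⇒false λ h →
      no-blocked-house 1≤a a<M (s≤s (s≤s z≤n)) ≤-refl (not-vacant⇒house (s≤s z≤n) (n≤1+n _) u) h
        (east-wall 1≤a a≤M) (not-vacant⇒house (s≤s z≤n) (n≤1+n _) l))

    latest-end : ⟦ latestUpper N ⟧ + ⟦ vacant b (3 + n₀) ⟧ ≡ 1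
    latest-end rewrite vacant-false {a} (east-wall 1≤a a≤M) | vacant-false {b} (east-wall (s≤s z≤n) b≤M)
      with true-or-false (vacant a (3 + n₀)) | true-or-false (vacant b (3 + n₀))
    ... | inj₁ u | inj₁ l = ⊥-elim (true≢false (cong₂ _∧_ u l) (no-vertical-vacancies 1≤a a<M (3 + n₀)))
    ... | inj₁ u | inj₂ l rewrite u | l = refl
    ... | inj₂ u | inj₁ l rewrite u | l = refl
    ... | inj₂ u | inj₂ l rewrite u | l | vacant-before-last-house-pair u l = refl

    vacancies-step : vacancies a + wallVacancies b ≡ vacancies b + 1
    vacancies-step = begin
      vacancies a + (⟦ vacant b 2 ⟧ + ⟦ vacant b (3 + n₀) ⟧)      ≡⟨ +-assoc (vacancies a) _ _ ⟨
      vacancies a + ⟦ vacant b 2 ⟧ + ⟦ vacant b (3 + n₀) ⟧        ≡⟨ cong (_+ ⟦ vacant b (3 + n₀) ⟧) telescoped ⟩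
      vacancies b + ⟦ latestUpper N ⟧ + ⟦ vacant b (3 + n₀) ⟧     ≡⟨ +-assoc (vacancies b) _ _ ⟩
      vacancies b + (⟦ latestUpper N ⟧ + ⟦ vacant b (3 + n₀) ⟧)   ≡⟨ cong (vacancies b +_) latest-end ⟩
      vacancies b + 1                                            ∎
      where
        open ≡-Reasoning
        latest-start : latestUpper 0 ≡ vacant b 2
        latest-start rewrite vacant-zero a | vacant-zero b = refl
        telescoped : vacancies a + ⟦ vacant b 2 ⟧ ≡ vacancies b + ⟦ latestUpper N ⟧
        telescoped = subst (λ s → vacancies a + ⟦ s ⟧ ≡ vacancies b + ⟦ latestUpper N ⟧) latest-start
          (∑-telescope _ _ (λ x → ⟦ latestUpper x ⟧) N latest-balance)

  singleton-1≡vacant-2 : ∀ {r} → 1 ≤ r → r ≤ M → singleton r 1 ≡ vacant r 2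
  singleton-1≡vacant-2 {r} 1≤r r≤M rewrite house-zero r | house-true {r} ≤-refl (s≤s z≤n) (west-wall 1≤r r≤M) =
    not-house≡vacant (s≤s z≤n) (s≤s (s≤s z≤n))

  singleton-N≡vacant-N-1 : ∀ {r} → 1 ≤ r → r ≤ M → singleton r N ≡ vacant r (3 + n₀)
  singleton-N≡vacant-N-1 {r} 1≤r r≤M rewrite house-true {r} (s≤s z≤n) ≤-refl (east-wall 1≤r r≤M) | house-beyond r =
    trans (∧-identityʳ _) (not-house≡vacant (s≤s z≤n) (n≤1+n _))

  end-singletons≡wallVacancies : ∀ {r} → 1 ≤ r → r ≤ M → ⟦ singleton r 1 ⟧ + ⟦ singleton r N ⟧ ≡ wallVacancies r
  end-singletons≡wallVacancies 1≤r r≤M =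
    cong₂ (λ s t → ⟦ s ⟧ + ⟦ t ⟧) (singleton-1≡vacant-2 1≤r r≤M) (singleton-N≡vacant-N-1 1≤r r≤M)

  wallVacancies≤2 : ∀ r → wallVacancies r ≤ 2
  wallVacancies≤2 r = +-mono-≤ (⟦⟧≤1 (vacant r 2)) (⟦⟧≤1 (vacant r (3 + n₀)))

  wallVacancies≤singletons : ∀ {r} → 1 ≤ r → r ≤ M → wallVacancies r ≤ singletons r
  wallVacancies≤singletons {r} 1≤r r≤M = subst (_≤ singletons r) (end-singletons≡wallVacancies 1≤r r≤M)
    (two-terms≤∑ (λ x → ⟦ singleton r x ⟧) N 1 N ≤-refl (s≤s (s≤s z≤n)) ≤-refl)

  interior-singleton : ∀ {r y} → 1 ≤ r → r ≤ M → 4 + y ≤ N → singleton r (3 + y) ≡ true →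
    (4 + y < N) × (C r (2 + y) ≡ false) × (C r (3 + y) ≡ true) × (C r (4 + y) ≡ false)
  interior-singleton {r} {y} 1≤r r≤M 4+y≤N s with not∧∧not-sound (house r (2 + y)) (house r (3 + y)) (house r (4 + y)) s
  ... | h₂ , h₃ , h₄ = j<n (vacant⇒surrounded 1≤r r≤M (s≤s z≤n) 4+y≤N v₄) ,
    not-house⇒vacant (s≤s z≤n) (≤-trans (n≤1+n _) (≤-trans (n≤1+n _) 4+y≤N)) h₂ , proj₂ (proj₂ (house-sound h₃)) , v₄
    where v₄ = not-house⇒vacant (s≤s z≤n) 4+y≤N h₄

  singletons≤wallVacancies+∑ : ∀ {r} (g : ℕ → ℕ) → 1 ≤ r → r ≤ M →
    (∀ y → 4 + y ≤ N → singleton r (3 + y) ≡ true → 1 ≤ g (3 + y)) → singletons r ≤ wallVacancies r + ∑ g N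
  singletons≤wallVacancies+∑ {r} g 1≤r r≤M interior = begin
    ∑ s (3 + n₀) + s N                 ≤⟨ +-monoˡ-≤ (s N) (∑-≤-head _ g (3 + n₀) bound) ⟩
    s 1 + ∑ g (3 + n₀) + s N           ≡⟨ xy∙z≈xz∙y (s 1) (∑ g (3 + n₀)) (s N) ⟩
    s 1 + s N + ∑ g (3 + n₀)           ≤⟨ +-monoʳ-≤ (s 1 + s N) (m≤m+n (∑ g (3 + n₀)) (g N)) ⟩
    s 1 + s N + ∑ g N                  ≡⟨ cong (_+ ∑ g N) (end-singletons≡wallVacancies 1≤r r≤M) ⟩
    wallVacancies r + ∑ g N           ∎
    where
      open ≤-Reasoning
      s : ℕ → ℕ
      s x = ⟦ singleton r x ⟧
      bound : ∀ x → 1 < x → x ≤ 3 + n₀ → s x ≤ g x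
      bound 1 (s≤s ()) _
      bound 2 _ _ rewrite house-true {r} ≤-refl (s≤s z≤n) (west-wall 1≤r r≤M) = z≤n
      bound (suc (suc (suc y))) _ 3+y≤N with true-or-false (singleton r (3 + y))
      ... | inj₁ s₁ rewrite s₁ = interior y (s≤s 3+y≤N) s₁
      ... | inj₂ s₀ rewrite s₀ = z≤n

  singleton⇒three-houses-two-rows-up : ∀ {r y} → 1 ≤ r → suc r < M → 4 + y < N →
    C (suc r) (2 + y) ≡ false → C (suc r) (3 + y) ≡ true → C (suc r) (4 + y) ≡ false →
    (1 < r) × (C (r ∸ 1) (2 + y) ≡ true) × (C (r ∸ 1) (3 + y) ≡ true) × (C (r ∸ 1) (4 + y) ≡ true)
  singleton⇒three-houses-two-rows-up {r} {y} 1≤r 1+r<M 4+y<N v₂ h₃ v₄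
    with vacant⇒altruist 1≤r r≤M (s≤s z≤n) (≤-trans (n≤1+n _) (<⇒≤ 4+y<N)) above
    where
      r≤M = ≤-trans (n≤1+n r) (<⇒≤ 1+r<M)
      above = ≢true⇒false λ c₃ → no-blocked-house 1≤r (<⇒≤ 1+r<M) (s≤s (s≤s z≤n)) (≤-trans (n≤1+n _) 4+y<N) c₃
        (house-above-vacant 1≤r (<⇒≤ 1+r<M) (s≤s z≤n) (≤-trans (n≤1+n _) (≤-trans (n≤1+n _) (<⇒≤ 4+y<N))) v₂)
        (house-above-vacant 1≤r (<⇒≤ 1+r<M) (s≤s z≤n) (<⇒≤ 4+y<N) v₄) h₃
  ... | blocks-west _ _ h = ⊥-elim (true≢false h v₂)
  ... | blocks-east _ _ h = ⊥-elim (true≢false h v₄)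
  ... | blocks-north 1<r c₂ c₃ c₄ = 1<r , c₂ , c₃ , c₄

  three-houses-over-two⇒triple : ∀ {r y} → 1 ≤ r → suc r < M → 4 + y < N →
    C r (2 + y) ≡ true → C r (3 + y) ≡ true → C r (4 + y) ≡ true →
    C (suc r) (2 + y) ≡ true → C (suc r) (4 + y) ≡ true → triple r (3 + y) ≡ true
  three-houses-over-two⇒triple {r} {y} 1≤r 1+r<M 4+y<N c₂ c₃ c₄ b₂ b₄ =
    triple-intro (house-false c₁) (house-true (s≤s z≤n) 2+y≤N c₂) (house-true (s≤s z≤n) 3+y≤N c₃)
      (house-true (s≤s z≤n) (<⇒≤ 4+y<N) c₄) (house-false c₅)
    where
      r<M = ≤-trans (n≤1+n _) 1+r<M
      3+y≤N = ≤-trans (n≤1+n _) (<⇒≤ 4+y<N)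
      2+y≤N = ≤-trans (n≤1+n _) 3+y≤N
      c₁ : C r (1 + y) ≡ false
      c₁ = ≢true⇒false λ c → no-blocked-house 1≤r r<M (s≤s (s≤s z≤n)) 3+y≤N c₂ c c₃ b₂
      c₅ : C r (5 + y) ≡ false
      c₅ = ≢true⇒false λ c → no-blocked-house 1≤r r<M (s≤s (s≤s z≤n)) 4+y<N c₄ c₃ c b₄

  singletons≤2+triples-two-rows-up : ∀ {r} → 1 ≤ r → 2 + r < M → singletons (2 + r) ≤ 2 + triples r
  singletons≤2+triples-two-rows-up {r} 1≤r 2+r<M = begin
    singletons (2 + r)                  ≤⟨ singletons≤wallVacancies+∑ (λ x → ⟦ triple r x ⟧) (s≤s z≤n) (<⇒≤ 2+r<M) interior ⟩
    wallVacancies (2 + r) + triples r  ≤⟨ +-monoˡ-≤ (triples r) (wallVacancies≤2 (2 + r)) ⟩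
    2 + triples r                       ∎
    where
      open ≤-Reasoning
      interior : ∀ y → 4 + y ≤ N → singleton (2 + r) (3 + y) ≡ true → 1 ≤ ⟦ triple r (3 + y) ⟧
      interior y 4+y≤N s with interior-singleton (s≤s z≤n) (<⇒≤ 2+r<M) 4+y≤N s
      ... | 4+y<N , v₂ , h₃ , v₄ with singleton⇒three-houses-two-rows-up (s≤s z≤n) 2+r<M 4+y<N v₂ h₃ v₄
      ...   | _ , c₂ , c₃ , c₄ rewrite three-houses-over-two⇒triple 1≤r (≤-trans (n≤1+n _) 2+r<M) 4+y<N c₂ c₃ c₄
                (house-above-vacant (s≤s z≤n) (≤-trans (n≤1+n _) 2+r<M) (s≤s z≤n)
                  (≤-trans (n≤1+n _) (≤-trans (n≤1+n _) (<⇒≤ 4+y<N))) v₂)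
                (house-above-vacant (s≤s z≤n) (≤-trans (n≤1+n _) 2+r<M) (s≤s z≤n) (<⇒≤ 4+y<N) v₄) = ≤-refl

  triple⇒houses : ∀ {r x} → triple r x ≡ true →
    (1 < x) × (suc x ≤ N) × (C r (x ∸ 1) ≡ true) × (C r x ≡ true) × (C r (suc x) ≡ true)
  triple⇒houses {r} {x} t
    with not∧∧∧∧not-sound (house r (x ∸ 2)) (house r (x ∸ 1)) (house r x) (house r (suc x)) (house r (2 + x)) t
  ... | h₋₁ , h₀ , h₁ with house-sound h₋₁ | house-sound h₁
  ...   | 1≤x∸1 , _ , c₋₁ | _ , 1+x≤N , c₁ = 1≤pred⇒1< 1≤x∸1 , 1+x≤N , c₋₁ , proj₂ (proj₂ (house-sound h₀)) , c₁
    where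
      1≤pred⇒1< : ∀ {x} → 1 ≤ x ∸ 1 → 1 < x
      1≤pred⇒1< {suc x} 1≤x = s≤s 1≤x

  no-triples-above-bottom : triples (2 + m₀) ≡ 0
  no-triples-above-bottom = ∑-zero _ N no-triple
    where
      no-triple : ∀ x → 1 ≤ x → x ≤ N → ⟦ triple (2 + m₀) x ⟧ ≡ 0
      no-triple x _ _ with true-or-false (triple (2 + m₀) x)
      ... | inj₂ t rewrite t = refl
      ... | inj₁ t with triple⇒houses t
      ...   | 1<x , 1+x≤N , c₋₁ , c₀ , c₁ = ⊥-elim (no-blocked-house (s≤s z≤n) ≤-refl 1<x 1+x≤N c₀ c₋₁ c₁
                (bottom-row (s≤s z≤n) (≤-trans (s≤s z≤n) 1<x) (<⇒≤ 1+x≤N)))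

  second-row-west : C 2 2 ≡ true → C 2 3 ≡ false → ⊥
  second-row-west c₂ v₃ with true-or-false (C 1 2)
  ... | inj₁ c = no-blocked-house ≤-refl (s≤s (s≤s z≤n)) (s≤s (s≤s z≤n)) (s≤s (s≤s (s≤s z≤n))) c
        (west-wall ≤-refl (s≤s z≤n)) (house-above-vacant ≤-refl (s≤s (s≤s z≤n)) (s≤s z≤n) (s≤s (s≤s (s≤s z≤n))) v₃) c₂
  ... | inj₂ v with vacant⇒altruist ≤-refl (s≤s z≤n) (s≤s z≤n) (s≤s (s≤s z≤n)) v
  ...   | blocks-west 2<2 _ _ = <-irrefl refl 2<2
  ...   | blocks-east _ _ c₃ = true≢false c₃ v₃
  ...   | blocks-north 1<1 _ _ _ = <-irrefl refl 1<1

  second-row-east : C 2 (3 + n₀) ≡ true → C 2 (2 + n₀) ≡ false → ⊥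
  second-row-east c v with true-or-false (C 1 (3 + n₀))
  ... | inj₁ c₁ = no-blocked-house ≤-refl (s≤s (s≤s z≤n)) (s≤s (s≤s z≤n)) ≤-refl c₁
        (house-above-vacant ≤-refl (s≤s (s≤s z≤n)) (s≤s z≤n) (≤-trans (n≤1+n _) (n≤1+n _)) v) (east-wall ≤-refl (s≤s z≤n)) c
  ... | inj₂ v₁ with vacant⇒altruist ≤-refl (s≤s z≤n) (s≤s z≤n) (n≤1+n _) v₁
  ...   | blocks-west _ _ c₂ = true≢false c₂ v
  ...   | blocks-east N<N _ _ = <-irrefl refl N<N
  ...   | blocks-north 1<1 _ _ _ = <-irrefl refl 1<1

  second-row-singletons : singletons 2 ≤ wallVacancies 2
  second-row-singletons = begin
    singletons 2                            ≤⟨ singletons≤wallVacancies+∑ (λ _ → 0) (s≤s z≤n) (s≤s (s≤s z≤n)) interior ⟩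
    wallVacancies 2 + ∑ (λ _ → 0) N        ≡⟨ cong (wallVacancies 2 +_) (∑-zero _ N λ _ _ _ → refl) ⟩
    wallVacancies 2 + 0                    ≡⟨ +-identityʳ _ ⟩
    wallVacancies 2                        ∎
    where
      open ≤-Reasoning
      interior : ∀ y → 4 + y ≤ N → singleton 2 (3 + y) ≡ true → 1 ≤ 0
      interior y 4+y≤N s with interior-singleton (s≤s z≤n) (s≤s (s≤s z≤n)) 4+y≤N s
      ... | 4+y<N , v₂ , h₃ , v₄ with singleton⇒three-houses-two-rows-up ≤-refl (s≤s (s≤s (s≤s z≤n))) 4+y<N v₂ h₃ v₄
      ...   | 1<1 , _ = ⊥-elim (<-irrefl refl 1<1)

  second-row-ends : 2 ≤ triples 2 + wallVacancies 2
  second-row-ends = begin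
    2                                                           ≤⟨ +-mono-≤ west-end east-end ⟩
    (⟦ triple 2 2 ⟧ + ⟦ vacant 2 2 ⟧) + (⟦ triple 2 (3 + n₀) ⟧ + ⟦ vacant 2 (3 + n₀) ⟧)
      ≡⟨ interchange ⟦ triple 2 2 ⟧ ⟦ vacant 2 2 ⟧ ⟦ triple 2 (3 + n₀) ⟧ ⟦ vacant 2 (3 + n₀) ⟧ ⟩
    (⟦ triple 2 2 ⟧ + ⟦ triple 2 (3 + n₀) ⟧) + wallVacancies 2
      ≤⟨ +-monoˡ-≤ (wallVacancies 2)
           (two-terms≤∑ (λ x → ⟦ triple 2 x ⟧) N 2 (3 + n₀) (s≤s z≤n) (s≤s (s≤s (s≤s z≤n))) (n≤1+n _)) ⟩
    triples 2 + wallVacancies 2                                ∎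
    where
      open ≤-Reasoning
      row2≤M : 2 ≤ M
      row2≤M = s≤s (s≤s z≤n)
      west-end : 1 ≤ ⟦ triple 2 2 ⟧ + ⟦ vacant 2 2 ⟧
      west-end with true-or-false (C 2 2)
      ... | inj₂ v rewrite vacant-true {2} (s≤s z≤n) (s≤s (s≤s z≤n)) v = m≤n+m 1 _
      ... | inj₁ c₂ with true-or-false (C 2 3)
      ...   | inj₂ v₃ = ⊥-elim (second-row-west c₂ v₃)
      ...   | inj₁ c₃ with true-or-false (C 2 4)
      ...     | inj₁ c₄ = ⊥-elim (no-four-in-a-row (s≤s z≤n) (s≤s (s≤s (s≤s z≤n))) ≤-refl (s≤s (s≤s (s≤s (s≤s z≤n))))
                  (west-wall (s≤s z≤n) row2≤M) c₂ c₃ c₄)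
      ...     | inj₂ v₄ rewrite triple-intro {2} {2} (house-zero 2) (house-true ≤-refl (s≤s z≤n) (west-wall (s≤s z≤n) row2≤M))
                  (house-true (s≤s z≤n) (s≤s (s≤s z≤n)) c₂) (house-true (s≤s z≤n) (s≤s (s≤s (s≤s z≤n))) c₃)
                  (house-false v₄) = s≤s z≤n
      east-end : 1 ≤ ⟦ triple 2 (3 + n₀) ⟧ + ⟦ vacant 2 (3 + n₀) ⟧
      east-end with true-or-false (C 2 (3 + n₀))
      ... | inj₂ v rewrite vacant-true {2} (s≤s z≤n) (n≤1+n _) v = m≤n+m 1 _
      ... | inj₁ c₃ with true-or-false (C 2 (2 + n₀))
      ...   | inj₂ v₂ = ⊥-elim (second-row-east c₃ v₂)
      ...   | inj₁ c₂ with true-or-false (C 2 (1 + n₀))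
      ...     | inj₁ c₁ = ⊥-elim (no-four-in-a-row (s≤s z≤n) (s≤s (s≤s (s≤s z≤n))) (s≤s z≤n) ≤-refl
                  c₁ c₂ c₃ (east-wall (s≤s z≤n) row2≤M))
      ...     | inj₂ v₁ rewrite triple-intro {2} {3 + n₀} (house-false v₁)
                  (house-true (s≤s z≤n) (≤-trans (n≤1+n _) (n≤1+n _)) c₂)
                  (house-true (s≤s z≤n) (n≤1+n _) c₃) (house-true (s≤s z≤n) ≤-refl (east-wall (s≤s z≤n) row2≤M))
                  (house-beyond 2) = s≤s z≤n

  wallVacancies-consecutive : ∀ {a} → 1 ≤ a → a < M → wallVacancies a + wallVacancies (suc a) ≤ 2
  wallVacancies-consecutive {a} 1≤a a<M = begin
    (⟦ vacant a 2 ⟧ + ⟦ vacant a (3 + n₀) ⟧) + (⟦ vacant (suc a) 2 ⟧ + ⟦ vacant (suc a) (3 + n₀) ⟧)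
      ≡⟨ interchange ⟦ vacant a 2 ⟧ ⟦ vacant a (3 + n₀) ⟧ ⟦ vacant (suc a) 2 ⟧ ⟦ vacant (suc a) (3 + n₀) ⟧ ⟩
    (⟦ vacant a 2 ⟧ + ⟦ vacant (suc a) 2 ⟧) + (⟦ vacant a (3 + n₀) ⟧ + ⟦ vacant (suc a) (3 + n₀) ⟧)
      ≤⟨ +-mono-≤ (⟦⟧+⟦⟧≤1 (vacant a 2) (vacant (suc a) 2) (no-vertical-vacancies 1≤a a<M 2))
                  (⟦⟧+⟦⟧≤1 (vacant a (3 + n₀)) (vacant (suc a) (3 + n₀)) (no-vertical-vacancies 1≤a a<M (3 + n₀))) ⟩
    2 ∎
    where open ≤-Reasoning

  row-101 : ∀ {r} → 1 ≤ r → r < M → C r 2 ≡ false →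
    (∀ x → 1 ≤ x → x ≤ N → triple r x ≡ false) → (∀ x → 1 < x → x < N → singleton r x ≡ false) →
    Blocks101 N C r
  row-101 {r} 1≤r r<M v₂ no-triple no-singleton zero =
    (λ _ → west-wall 1≤r (<⇒≤ r<M)) , (λ _ → v₂) ,
    (λ _ → east (vacant⇒surrounded 1≤r (<⇒≤ r<M) (s≤s z≤n) (s≤s (s≤s z≤n)) v₂))
  row-101 {r} 1≤r r<M v₂ no-triple no-singleton (suc t) with row-101 1≤r r<M v₂ no-triple no-singleton t
  ... | _ , v , c = c₄ , v₅ , c₆
    where
      c₄ : 4 + t * 3 ≤ N → C r (4 + t * 3) ≡ true
      c₄ 4+3t≤N = ≢false⇒true λ v₄ → true≢false
        (singleton-intro (house-false (v (≤-trans (n≤1+n _) (≤-trans (n≤1+n _) 4+3t≤N))))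
          (house-true (s≤s z≤n) (≤-trans (n≤1+n _) 4+3t≤N) (c (≤-trans (n≤1+n _) 4+3t≤N))) (house-false v₄))
        (no-singleton (3 + t * 3) (s≤s (s≤s z≤n)) 4+3t≤N)
      v₅ : 5 + t * 3 ≤ N → C r (5 + t * 3) ≡ false
      v₅ 5+3t≤N = ≢true⇒false λ c₅ → true≢false
        (triple-intro (house-false (v 2+3t≤N)) (house-true (s≤s z≤n) 3+3t≤N (c 3+3t≤N))
          (house-true (s≤s z≤n) 4+3t≤N (c₄ 4+3t≤N)) (house-true (s≤s z≤n) 5+3t≤N c₅) (no-house-after c₅))
        (no-triple (4 + t * 3) (s≤s z≤n) 4+3t≤N)
        where
          4+3t≤N = ≤-trans (n≤1+n _) 5+3t≤N
          3+3t≤N = ≤-trans (n≤1+n _) 4+3t≤N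
          2+3t≤N = ≤-trans (n≤1+n _) 3+3t≤N
          no-house-after : C r (5 + t * 3) ≡ true → house r (6 + t * 3) ≡ false
          no-house-after c₅ with m≤n⇒m<n∨m≡n 5+3t≤N
          ... | inj₂ refl = house-beyond r
          ... | inj₁ 5+3t<N = house-false (≢true⇒false λ c₆ →
                no-four-in-a-row 1≤r r<M (s≤s z≤n) 5+3t<N (c 3+3t≤N) (c₄ 4+3t≤N) c₅ c₆)
      c₆ : 6 + t * 3 ≤ N → C r (6 + t * 3) ≡ true
      c₆ 6+3t≤N = east (vacant⇒surrounded 1≤r (<⇒≤ r<M) (s≤s z≤n) (≤-trans (n≤1+n _) 6+3t≤N) (v₅ (≤-trans (n≤1+n _) 6+3t≤N)))

  rowUp : ℕ → ℕ
  rowUp d = M ∸ d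

  1≤rowUp : ∀ {d} → d < M → 1 ≤ rowUp d
  1≤rowUp = m<n⇒0<n∸m

  rowUp<M : ∀ {d} → 1 ≤ d → d ≤ M → rowUp d < M
  rowUp<M 1≤d d≤M = ∸-monoʳ-< 1≤d d≤M

  suc-rowUp-suc : ∀ {d} → d < M → suc (rowUp (suc d)) ≡ rowUp d
  suc-rowUp-suc = suc[m∸suc-d]≡m∸d

  rowUp-2+ : ∀ {d} → suc d < M → 2 + rowUp (2 + d) ≡ rowUp d
  rowUp-2+ 1+d<M = trans (cong suc (suc-rowUp-suc 1+d<M)) (suc-rowUp-suc (≤-trans (n≤1+n _) 1+d<M))

  rowUp-1+m₀ : rowUp (1 + m₀) ≡ 2
  rowUp-1+m₀ = m+n∸n≡m 2 (1 + m₀)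

  rowUp-2+m₀ : rowUp (2 + m₀) ≡ 1
  rowUp-2+m₀ = m+n∸n≡m 1 (2 + m₀)

  module _ {d} (1≤d : 1 ≤ d) (1+d<M : suc d < M) where
    private
      d<M = ≤-trans (n≤1+n _) 1+d<M
      1+rowUp-suc<M = subst (_< M) (sym (suc-rowUp-suc d<M)) (rowUp<M 1≤d (<⇒≤ d<M))

    vacancies-step↑ : vacancies (rowUp (suc d)) + wallVacancies (rowUp d) ≡ vacancies (rowUp d) + 1
    vacancies-step↑ = subst (λ b → vacancies (rowUp (suc d)) + wallVacancies b ≡ vacancies b + 1) (suc-rowUp-suc d<M)
      (ConsecutiveRows.vacancies-step (1≤rowUp 1+d<M) 1+rowUp-suc<M)

    wallVacancies-consecutive↑ : wallVacancies (rowUp d) + wallVacancies (rowUp (suc d)) ≤ 2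
    wallVacancies-consecutive↑ = subst (λ b → b ≤ 2) (+-comm (wallVacancies (rowUp (suc d))) _)
      (subst (λ b → wallVacancies (rowUp (suc d)) + wallVacancies b ≤ 2) (suc-rowUp-suc d<M)
        (wallVacancies-consecutive (1≤rowUp 1+d<M) (≤-trans (n≤1+n _) 1+rowUp-suc<M)))

  vacancyPair : ℕ → ℕ
  vacancyPair d = vacancies (rowUp d) + vacancies (rowUp (suc d))

  vacancyPair-step : ∀ {d} → 1 ≤ d → 2 + d < M →
    vacancyPair (suc d) + (wallVacancies (rowUp d) + wallVacancies (rowUp (suc d))) ≡ vacancyPair d + 2
  vacancyPair-step {d} 1≤d 2+d<M = begin
    (z₁ + z₂) + (w₀ + w₁)   ≡⟨ interchange z₁ z₂ w₀ w₁ ⟩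
    (z₁ + w₀) + (z₂ + w₁)   ≡⟨ cong₂ _+_ (vacancies-step↑ 1≤d (≤-trans (n≤1+n _) 2+d<M)) (vacancies-step↑ (s≤s z≤n) 2+d<M) ⟩
    (z₀ + 1) + (z₁ + 1)     ≡⟨ interchange z₀ 1 z₁ 1 ⟩
    (z₀ + z₁) + 2           ∎
    where
      open ≡-Reasoning
      z₀ = vacancies (rowUp d)
      z₁ = vacancies (rowUp (suc d))
      z₂ = vacancies (rowUp (2 + d))
      w₀ = wallVacancies (rowUp d)
      w₁ = wallVacancies (rowUp (suc d))

  vacancyPair-mono : ∀ {d} → 1 ≤ d → 2 + d < M → vacancyPair d ≤ vacancyPair (suc d)
  vacancyPair-mono {d} 1≤d 2+d<M = +-cancelʳ-≤ 2 _ _ (begin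
    vacancyPair d + 2                   ≡⟨ vacancyPair-step 1≤d 2+d<M ⟨
    vacancyPair (suc d) + (wallVacancies (rowUp d) + wallVacancies (rowUp (suc d)))
                                        ≤⟨ +-monoʳ-≤ _ (wallVacancies-consecutive↑ 1≤d (≤-trans (n≤1+n _) 2+d<M)) ⟩
    vacancyPair (suc d) + 2             ∎)
    where open ≤-Reasoning

  vacancyPair-range : ∀ {d e} → 1 ≤ d → d ≤ e → e ≤ 1 + m₀ → vacancyPair d ≤ vacancyPair e
  vacancyPair-range = ≤-steps vacancyPair (λ k 1≤k 1+k≤1+m₀ → vacancyPair-mono 1≤k (s≤s (s≤s 1+k≤1+m₀)))

  penultimate-row-identity : N + singletons (2 + m₀) ≡ 3 * vacancies (2 + m₀) + 2
  penultimate-row-identity = begin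
    N + singletons (2 + m₀)                             ≡⟨ row-identity (s≤s z≤n) ≤-refl ⟩
    3 * vacancies (2 + m₀) + triples (2 + m₀) + 2       ≡⟨ cong (λ t → 3 * vacancies (2 + m₀) + t + 2) no-triples-above-bottom ⟩
    3 * vacancies (2 + m₀) + 0 + 2                      ≡⟨ cong (_+ 2) (+-identityʳ _) ⟩
    3 * vacancies (2 + m₀) + 2                          ∎
    where open ≡-Reasoning

  -- Rows 2 + m₀ and 2 are compared through the monotone chain of vacancy pairs; the row identities
  -- and the end conditions of both rows leave no slack, so every inequality on the way is an equality.
  extreme-rows : (wallVacancies (2 + m₀) ≡ 2) × (singletons (2 + m₀) ≡ 2) × (wallVacancies 2 ≡ 2) ×
                 (triples 2 ≡ 0) × (vacancyPair 1 ≡ vacancyPair (1 + m₀))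
  extreme-rows =
    let (w≡2 , c≡2 , w₂≡2 , K≡0 , pairs-equal) = squeeze-pairs pairs-ordered balance second-row-singletons
          (wallVacancies≤2 2) (wallVacancies≤2 _) (wallVacancies≤singletons (s≤s z≤n) (n≤1+n _)) second-row-ends
    in w≡2 , c≡2 , w₂≡2 , K≡0 , trans pairs-equal (sym top-vacancyPair)
    where
      Y = vacancies (2 + m₀)
      X = vacancies (1 + m₀)
      V = vacancies 2
      U = vacancies 1
      w = wallVacancies (2 + m₀)
      w₂ = wallVacancies 2
      c = singletons (2 + m₀)
      p = singletons 2
      K = triples 2
      bottom-pair : X + w ≡ Y + 1
      bottom-pair = ConsecutiveRows.vacancies-step (s≤s z≤n) ≤-refl
      top-pair : U + w₂ ≡ V + 1
      top-pair = ConsecutiveRows.vacancies-step ≤-refl (s≤s (s≤s (s≤s z≤n)))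
      top-row-identity : N + p ≡ 3 * V + K + 2
      top-row-identity = row-identity (s≤s z≤n) (s≤s (s≤s (s≤s z≤n)))
      top-vacancyPair : vacancyPair (1 + m₀) ≡ V + U
      top-vacancyPair = cong₂ (λ r s → vacancies r + vacancies s) rowUp-1+m₀ rowUp-2+m₀
      pairs-ordered : Y + X ≤ V + U
      pairs-ordered = subst (Y + X ≤_) top-vacancyPair (vacancyPair-range ≤-refl (s≤s z≤n) ≤-refl)
      balance : 3 * (Y + X) + (3 * w + 2 * p) ≡ 3 * (V + U) + (3 * w₂ + 2 * K + 2 * c)
      balance = pair-balance {N} {Y} {X} {V} {U} {w} {w₂} {c} {p} {K}
        bottom-pair top-pair penultimate-row-identity top-row-identity

  wallVacancies-pair≡2 : ∀ {d} → 1 ≤ d → d ≤ m₀ → wallVacancies (rowUp d) + wallVacancies (rowUp (suc d)) ≡ 2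
  wallVacancies-pair≡2 {d} 1≤d d≤m₀ = ≤-antisym (wallVacancies-consecutive↑ 1≤d 1+d<M) (+-cancelˡ-≤ (vacancyPair d) _ _ (begin
    vacancyPair d + 2                ≡⟨ vacancyPair-step 1≤d 2+d<M ⟨
    vacancyPair (suc d) + pair       ≤⟨ +-monoˡ-≤ pair pair-bound ⟩
    vacancyPair d + pair             ∎))
    where
      open ≤-Reasoning
      2+d<M = s≤s (s≤s (s≤s d≤m₀))
      1+d<M = ≤-trans (n≤1+n _) 2+d<M
      pair = wallVacancies (rowUp d) + wallVacancies (rowUp (suc d))
      pair-bound : vacancyPair (suc d) ≤ vacancyPair d
      pair-bound = begin
        vacancyPair (suc d)   ≤⟨ vacancyPair-range (s≤s z≤n) (s≤s d≤m₀) ≤-refl ⟩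
        vacancyPair (1 + m₀)  ≡⟨ proj₂ (proj₂ (proj₂ (proj₂ extreme-rows))) ⟨
        vacancyPair 1         ≤⟨ vacancyPair-range ≤-refl 1≤d (m≤n⇒m≤1+n d≤m₀) ⟩
        vacancyPair d         ∎

  vacancies-two-up : ∀ {d} → 1 ≤ d → d ≤ m₀ → vacancies (rowUp (2 + d)) ≡ vacancies (rowUp d)
  vacancies-two-up {d} 1≤d d≤m₀ = +-cancelˡ-≡ z₁ _ _ (trans pairs-equal (+-comm z₀ z₁))
    where
      z₀ = vacancies (rowUp d)
      z₁ = vacancies (rowUp (suc d))
      pairs-equal : vacancyPair (suc d) ≡ vacancyPair d
      pairs-equal = +-cancelʳ-≡ 2 _ _ (trans (cong (vacancyPair (suc d) +_) (sym (wallVacancies-pair≡2 1≤d d≤m₀)))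
        (vacancyPair-step 1≤d (s≤s (s≤s (s≤s d≤m₀)))))

  alternating-depths : ∀ k →
    (1 + double k ≤ 1 + m₀ →
      (wallVacancies (rowUp (1 + double k)) ≡ 2) × (vacancies (rowUp (1 + double k)) ≡ vacancies (2 + m₀))) ×
    (2 + double k ≤ 1 + m₀ → wallVacancies (rowUp (2 + double k)) ≡ 0)
  alternating-depths zero = (λ _ → proj₁ extreme-rows , refl) ,
    (λ 2≤1+m₀ → +-cancelˡ-≡ 2 _ _ (trans (cong (_+ wallVacancies (rowUp 2)) (sym (proj₁ extreme-rows)))
      (wallVacancies-pair≡2 ≤-refl (≤-pred 2≤1+m₀))))
  alternating-depths (suc k) with alternating-depths k
  ... | odd , even = odd′ , even′
    where
      odd′ : 3 + double k ≤ 1 + m₀ →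
        (wallVacancies (rowUp (3 + double k)) ≡ 2) × (vacancies (rowUp (3 + double k)) ≡ vacancies (2 + m₀))
      odd′ 3+2k≤1+m₀ =
        trans (cong (_+ wallVacancies (rowUp (3 + double k))) (sym (even (≤-trans (n≤1+n _) 3+2k≤1+m₀))))
              (wallVacancies-pair≡2 (s≤s z≤n) (≤-pred 3+2k≤1+m₀)) ,
        trans (vacancies-two-up (s≤s z≤n) (≤-trans (n≤1+n _) (≤-pred 3+2k≤1+m₀)))
              (proj₂ (odd (≤-trans (n≤1+n _) (≤-trans (n≤1+n _) 3+2k≤1+m₀))))
      even′ : 4 + double k ≤ 1 + m₀ → wallVacancies (rowUp (4 + double k)) ≡ 0
      even′ 4+2k≤1+m₀ = +-cancelˡ-≡ 2 _ _
        (trans (cong (_+ wallVacancies (rowUp (4 + double k))) (sym (proj₁ (odd′ (≤-trans (n≤1+n _) 4+2k≤1+m₀)))))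
               (wallVacancies-pair≡2 (s≤s z≤n) (≤-pred 4+2k≤1+m₀)))

  m₀-even : ∃ λ h → m₀ ≡ double h
  m₀-even with even-or-odd m₀
  ... | inj₁ even = even
  ... | inj₂ (h , m₀≡1+2h) = ⊥-elim (2≢0 (begin
    2                                     ≡⟨ proj₁ (proj₂ (proj₂ extreme-rows)) ⟨
    wallVacancies 2                      ≡⟨ cong wallVacancies (trans (sym rowUp-1+m₀) (cong rowUp (cong suc m₀≡1+2h))) ⟩
    wallVacancies (rowUp (2 + double h)) ≡⟨ proj₂ (alternating-depths h) (≤-reflexive (cong suc (sym m₀≡1+2h))) ⟩
    0                                     ∎))
    where
      open ≡-Reasoning
      2≢0 : 2 ≢ 0
      2≢0 ()

  N≡3*vacancies : N ≡ 3 * vacancies (2 + m₀)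
  N≡3*vacancies = +-cancelʳ-≡ 2 _ _ (trans (cong (N +_) (sym (proj₁ (proj₂ extreme-rows)))) penultimate-row-identity)

  module _ {k} (1+2k≤1+m₀ : 1 + double k ≤ 1 + m₀) where
    private
      r = rowUp (1 + double k)
      1+2k<M : 1 + double k < M
      1+2k<M = ≤-trans (s≤s 1+2k≤1+m₀) (n≤1+n _)

    singletons≡triples+2 : singletons r ≡ triples r + 2
    singletons≡triples+2 = +-cancelˡ-≡ N _ _ (begin
      N + singletons r                  ≡⟨ row-identity (1≤rowUp 1+2k<M) (rowUp<M (s≤s z≤n) (<⇒≤ 1+2k<M)) ⟩
      3 * vacancies r + triples r + 2   ≡⟨ cong (λ z → 3 * z + triples r + 2) (proj₂ (proj₁ (alternating-depths k) 1+2k≤1+m₀)) ⟩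
      3 * vacancies (2 + m₀) + triples r + 2 ≡⟨ cong (λ n → n + triples r + 2) N≡3*vacancies ⟨
      N + triples r + 2                 ≡⟨ +-assoc N _ 2 ⟩
      N + (triples r + 2)               ∎)
      where open ≡-Reasoning

  module _ {h} (m₀≡2h : m₀ ≡ double h) where
    private
      rowUp-1+2h : rowUp (1 + double h) ≡ 2
      rowUp-1+2h = trans (cong (λ d → rowUp (1 + d)) (sym m₀≡2h)) rowUp-1+m₀

      1+2k≤1+m₀ : ∀ {k} → k ≤ h → 1 + double k ≤ 1 + m₀
      1+2k≤1+m₀ {k} k≤h = s≤s (subst (double k ≤_) (sym m₀≡2h) (double-mono-≤ k≤h))

    triples-two-rows-down : ∀ k → suc k ≤ h → triples (rowUp (1 + double k)) ≤ triples (rowUp (3 + double k))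
    triples-two-rows-down k 1+k≤h = +-cancelʳ-≤ 2 _ _ (begin
      triples (rowUp (1 + double k)) + 2  ≡⟨ singletons≡triples+2 {k} (1+2k≤1+m₀ (≤-trans (n≤1+n k) 1+k≤h)) ⟨
      singletons (rowUp (1 + double k))   ≡⟨ cong singletons (rowUp-2+ 2+2k<M) ⟨
      singletons (2 + rowUp (3 + double k))
        ≤⟨ singletons≤2+triples-two-rows-up (1≤rowUp 3+2k<M)
             (subst (_< M) (sym (rowUp-2+ 2+2k<M)) (rowUp<M (s≤s z≤n) (<⇒≤ 1+2k<M))) ⟩
      2 + triples (rowUp (3 + double k))  ≡⟨ +-comm 2 _ ⟩
      triples (rowUp (3 + double k)) + 2  ∎)
      where
        open ≤-Reasoning
        3+2k<M : 3 + double k < M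
        3+2k<M = ≤-trans (s≤s (1+2k≤1+m₀ {suc k} 1+k≤h)) (n≤1+n _)
        2+2k<M : 2 + double k < M
        2+2k<M = ≤-trans (n≤1+n _) 3+2k<M
        1+2k<M : 1 + double k < M
        1+2k<M = ≤-trans (n≤1+n _) 2+2k<M

    no-triples-at-odd-depth : ∀ k → k ≤ h → triples (rowUp (1 + double k)) ≡ 0
    no-triples-at-odd-depth k k≤h = n≤0⇒n≡0 (begin
      triples (rowUp (1 + double k))
        ≤⟨ ≤-steps (λ k → triples (rowUp (1 + double k))) (λ k _ → triples-two-rows-down k) z≤n k≤h ≤-refl ⟩
      triples (rowUp (1 + double h))      ≡⟨ cong triples rowUp-1+2h ⟩
      triples 2                           ≡⟨ proj₁ (proj₂ (proj₂ (proj₂ extreme-rows))) ⟩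
      0                                   ∎)
      where open ≤-Reasoning

    odd-depth-row-101′ : ∀ k → 1 ≤ rowUp (1 + double k) → Row101 N C (rowUp (1 + double k))
    odd-depth-row-101′ k 1≤r = blocks⇒Row101 {N} {C} {r} (row-101 1≤r r<M vacant-2 no-triple no-interior-singleton)
      where
        r = rowUp (1 + double k)
        1+2k<M : 1 + double k < M
        1+2k<M = m∸n≢0⇒n<m (n>0⇒n≢0 1≤r)
        k≤h : k ≤ h
        k≤h = double-cancel-≤ k h (≤-pred (≤-pred (subst (1 + double k <_) (cong (3 +_) m₀≡2h) 1+2k<M)))
        r<M : r < M
        r<M = rowUp<M (s≤s z≤n) (<⇒≤ 1+2k<M)
        ends : (vacant r 2 ≡ true) × (vacant r (3 + n₀) ≡ true)
        ends = ⟦⟧+⟦⟧≡2⇒both _ _ (proj₁ (proj₁ (alternating-depths k) (1+2k≤1+m₀ k≤h)))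
        vacant-2 : C r 2 ≡ false
        vacant-2 = proj₂ (proj₂ (vacant-sound (proj₁ ends)))
        triples≡0 : triples r ≡ 0
        triples≡0 = no-triples-at-odd-depth k k≤h
        no-triple : ∀ x → 1 ≤ x → x ≤ N → triple r x ≡ false
        no-triple x 1≤x x≤N = ⟦⟧≡0⇒false (∑≡0⇒term≡0 (λ x → ⟦ triple r x ⟧) N triples≡0 x 1≤x x≤N)
        singletons≡2 : singletons r ≡ 2
        singletons≡2 = trans (singletons≡triples+2 {k} (1+2k≤1+m₀ k≤h)) (cong (_+ 2) triples≡0)
        no-interior-singleton : ∀ x → 1 < x → x < N → singleton r x ≡ false
        no-interior-singleton x 1<x x<N = ⟦⟧≡0⇒false (n≤0⇒n≡0 (+-cancelˡ-≤ 1 _ _ (+-cancelʳ-≤ 1 _ _ (begin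
          1 + ⟦ singleton r x ⟧ + 1                          ≡⟨ cong₂ (λ a b → a + ⟦ singleton r x ⟧ + b) first last ⟨
          ⟦ singleton r 1 ⟧ + ⟦ singleton r x ⟧ + ⟦ singleton r N ⟧
            ≤⟨ three-terms≤∑ (λ x → ⟦ singleton r x ⟧) N 1 x N ≤-refl 1<x x<N ≤-refl ⟩
          singletons r                                       ≡⟨ singletons≡2 ⟩
          2                                                  ∎))))
          where
            open ≤-Reasoning
            first : ⟦ singleton r 1 ⟧ ≡ 1
            first = cong ⟦_⟧ (trans (singleton-1≡vacant-2 (1≤rowUp 1+2k<M) (<⇒≤ r<M)) (proj₁ ends))
            last : ⟦ singleton r N ⟧ ≡ 1
            last = cong ⟦_⟧ (trans (singleton-N≡vacant-N-1 (1≤rowUp 1+2k<M) (<⇒≤ r<M)) (proj₂ ends))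

  odd-depth-row-101 : ∀ k → 1 ≤ rowUp (1 + double k) → Row101 N C (rowUp (1 + double k))
  odd-depth-row-101 with m₀-even
  ... | h , m₀≡2h = odd-depth-row-101′ {h} m₀≡2h

module Narrow {m} {C : Config} (es : EvolutionaryStable m 3 C) where

  open Stable es

  private
    1≤m∸suc : ∀ {d} → suc d < m → 1 ≤ m ∸ suc d
    1≤m∸suc = m<n⇒0<n∸m

    m∸suc<m : ∀ {d} → suc d < m → m ∸ suc d < m
    m∸suc<m 1+d<m = ∸-monoʳ-< (s≤s z≤n) (<⇒≤ 1+d<m)

  vacant-over-house : ∀ {d} → (d < m → C (m ∸ d) 2 ≡ true) → 1 + d < m → C (m ∸ suc d) 2 ≡ false
  vacant-over-house {d} below 1+d<m = ≢true⇒false λ c → no-blocked-house (1≤m∸suc 1+d<m) (m∸suc<m 1+d<m)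
    (s≤s (s≤s z≤n)) (s≤s (s≤s (s≤s z≤n))) c
    (west-column (1≤m∸suc 1+d<m) (<⇒≤ (m∸suc<m 1+d<m)) (s≤s z≤n)) (east-column (1≤m∸suc 1+d<m) (<⇒≤ (m∸suc<m 1+d<m)) (s≤s z≤n))
    (subst (λ i → C i 2 ≡ true) (sym (suc[m∸suc-d]≡m∸d d<m)) (below d<m))
    where d<m = ≤-trans (n≤1+n _) 1+d<m

  house-over-vacant : ∀ {d} → (d < m → C (m ∸ d) 2 ≡ false) → 1 + d < m → C (m ∸ suc d) 2 ≡ true
  house-over-vacant {d} below 1+d<m = house-above-vacant (1≤m∸suc 1+d<m) (m∸suc<m 1+d<m) (s≤s z≤n) (s≤s (s≤s z≤n))
    (subst (λ i → C i 2 ≡ false) (sym (suc[m∸suc-d]≡m∸d d<m)) (below d<m))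
    where d<m = ≤-trans (n≤1+n _) 1+d<m

  middle-column : ∀ k → (double k < m → C (m ∸ double k) 2 ≡ true) × (1 + double k < m → C (m ∸ (1 + double k)) 2 ≡ false)
  middle-column zero = bottom , vacant-over-house bottom
    where bottom = λ 0<m → bottom-row 0<m (s≤s z≤n) (s≤s (s≤s z≤n))
  middle-column (suc k) = even , vacant-over-house even
    where even = house-over-vacant (proj₂ (middle-column k))

  odd-depth-row-101 : ∀ k → 1 ≤ m ∸ (1 + double k) → Row101 3 C (m ∸ (1 + double k))
  odd-depth-row-101 k 1≤r = blocks⇒Row101 {3} {C} {m ∸ (1 + double k)} blocks
    where
      r≤m : m ∸ (1 + double k) ≤ m
      r≤m = m∸n≤m m (1 + double k)
      blocks : Blocks101 3 C (m ∸ (1 + double k))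
      blocks zero = (λ _ → west-column 1≤r r≤m (s≤s z≤n)) , (λ _ → proj₂ (middle-column k) (m∸n≢0⇒n<m (n>0⇒n≢0 1≤r))) ,
                    (λ _ → east-column 1≤r r≤m (s≤s z≤n))
      blocks (suc t) = (λ { (s≤s (s≤s (s≤s ()))) }) , (λ { (s≤s (s≤s (s≤s ()))) }) , (λ { (s≤s (s≤s (s≤s ()))) })

odd-depth-rows-101 : ∀ {m n C} → 2 < m → 2 < n → EvolutionaryStable m n C →
  ∀ k → 1 ≤ m ∸ (1 + double k) → Row101 n C (m ∸ (1 + double k))
odd-depth-rows-101 {n = 3} _ _ es = Narrow.odd-depth-row-101 es
odd-depth-rows-101 {n = 1} _ (s≤s ())
odd-depth-rows-101 {n = 2} _ (s≤s (s≤s ()))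
odd-depth-rows-101 {m = suc (suc (suc m₀))} {n = suc (suc (suc (suc n₀)))} (s≤s (s≤s (s≤s _))) _ es =
  Wide.odd-depth-row-101 m₀ n₀ es

proposition5p12 : (m n : ℕ) → 2 < m → 2 < n → (C : Config) →
    EvolutionaryStable m n C →
    (k : ℕ) → 1 ≤ m ∸ (1 + 2 * k) →
    (j : ℕ) → 1 ≤ j → j ≤ n →
      (j % 3 ≡ 2 → C (m ∸ (1 + 2 * k)) j ≡ false) ×
      (j % 3 ≢ 2 → C (m ∸ (1 + 2 * k)) j ≡ true)
proposition5p12 m n 2<m 2<n C es k with 2 * k | double≡2* k
... | .(double k) | refl = odd-depth-rows-101 2<m 2<n es k
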